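{- For all integers $k\geq 0$ and $q\geq 1$, there exists a $q$-cuttable unrooted binary phylogenetic network that is strictly level-$k$.
   Context: An unrooted binary phylogenetic network on a non-empty finite set $X$ is a simple connected undirected graph whose internal vertices have degree $3$ and whose degree-$1$ vertices (leaves) are bijectively labeled by $X$. A cut-edge is an edge whose deletion disconnects the graph. A blob is a maximal subgraph with no cut-edge that is not a single vertex. $U$ is $q$-cuttable if every cycle contains a path of at least $q$ vertices each incident to a cut-edge. $U$ is level-$k$ if a tree can be obtained from $U$ by deleting at most $k$ edges from each blob, and strictly level-$k$ if it is level-$k$ but not level-$(k-1)$. -}

module Defs where

open import Data.Nat using (ℕ; zero; suc; _≤_)
open import Data.Fin using (Fin)
open import Data.Bool using (Bool; true; false; if_then_else_)
open import Data.List using (List; []; _∷_; _++_; [_]; length; map; allFin; take; drop)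
open import Data.Nat.ListAction using (sum)
open import Data.List.Membership.Propositional using (_∈_)
open import Data.List.Relation.Unary.All using (All)
open import Data.List.Relation.Unary.Unique.Propositional using (Unique)
open import Data.Product using (Σ; ∃; ∃-syntax; _×_; _,_; proj₁; proj₂; swap)
open import Data.Sum using (_⊎_)
open import Data.Unit using (⊤)
open import Relation.Nullary using (¬_)
open import Relation.Binary.PropositionalEquality using (_≡_; _≢_)

-- Graphs on the vertex set Fin n, given by a Bool-valued adjacency
-- (simple undirected graph: symmetric and irreflexive, see IsUBN).

Rel : ℕ → Set₁
Rel n = Fin n → Fin n → Set

Edge : {n : ℕ} → (Fin n → Fin n → Bool) → Rel n
Edge adj x y = adj x y ≡ true

data Walk {n : ℕ} (R : Rel n) : Fin n → Fin n → Set where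
  stay : ∀ x → Walk R x x
  step : ∀ {x y z} → R x y → Walk R y z → Walk R x z

ConnectedOn : {n : ℕ} → (Fin n → Set) → Rel n → Set
ConnectedOn V R = ∀ x y → V x → V y → Walk R x y

Connected : {n : ℕ} → Rel n → Set
Connected R = ∀ x y → Walk R x y

removeEdge : {n : ℕ} → Rel n → Fin n → Fin n → Rel n
removeEdge R a b x y = R x y × ¬ ((x ≡ a × y ≡ b) ⊎ (x ≡ b × y ≡ a))

removeEdges : {n : ℕ} → Rel n → List (Fin n × Fin n) → Rel n
removeEdges R D x y = R x y × ¬ (((x , y) ∈ D) ⊎ ((y , x) ∈ D))

deg : {n : ℕ} → (Fin n → Fin n → Bool) → Fin n → ℕ
deg {n} adj v = sum (map (λ w → if adj v w then 1 else 0) (allFin n))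

ConsecRel : {n : ℕ} → Rel n → List (Fin n) → Set
ConsecRel R [] = ⊤
ConsecRel R (x ∷ []) = ⊤
ConsecRel R (x ∷ y ∷ zs) = R x y × ConsecRel R (y ∷ zs)

IsCycle : {n : ℕ} → Rel n → List (Fin n) → Set
IsCycle R cs =
  3 ≤ length cs × Unique cs ×
  Σ _ λ x → Σ _ λ rest → (cs ≡ x ∷ rest) × ConsecRel R (cs ++ [ x ])

IsTree : {n : ℕ} → Rel n → Set
IsTree R = Connected R × (∀ cs → ¬ IsCycle R cs)

-- Unrooted binary phylogenetic networks on X = Fin m (m ≥ 1), with
-- n vertices Fin n and adjacency adj.

record IsUBN (m n : ℕ) (adj : Fin n → Fin n → Bool) : Set where
  field
    nonemptyX  : 1 ≤ m
    symmetric  : ∀ x y → adj x y ≡ adj y x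
    irreflex   : ∀ x → adj x x ≡ false
    connected  : Connected (Edge adj)
    degree13   : ∀ v → deg adj v ≡ 1 ⊎ deg adj v ≡ 3
    label      : Fin m → Fin n
    label-inj  : ∀ i j → label i ≡ label j → i ≡ j
    label-leaf : ∀ i → deg adj (label i) ≡ 1
    label-onto : ∀ v → deg adj v ≡ 1 → ∃[ i ] label i ≡ v

IsCutEdge : {n : ℕ} → (Fin n → Fin n → Bool) → Fin n → Fin n → Set
IsCutEdge adj a b = Edge adj a b × ¬ Connected (removeEdge (Edge adj) a b)

IncidentToCutEdge : {n : ℕ} → (Fin n → Fin n → Bool) → Fin n → Set
IncidentToCutEdge adj v = ∃[ w ] IsCutEdge adj v w

record Subgraph {n : ℕ} (adj : Fin n → Fin n → Bool) : Set where
  field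
    V    : Fin n → Bool
    E    : Fin n → Fin n → Bool
    Esym : ∀ x y → E x y ≡ E y x
    Esub : ∀ x y → E x y ≡ true → adj x y ≡ true × V x ≡ true × V y ≡ true

module _ {n : ℕ} {adj : Fin n → Fin n → Bool} where
  open Subgraph

  Vs : Subgraph adj → Fin n → Set
  Vs H x = V H x ≡ true

  Es : Subgraph adj → Rel n
  Es H x y = E H x y ≡ true

  IsBridgelessSub : Subgraph adj → Set
  IsBridgelessSub H =
    ConnectedOn (Vs H) (Es H) ×
    (∀ a b → Es H a b → ConnectedOn (Vs H) (removeEdge (Es H) a b)) ×
    (∃[ x ] ∃[ y ] Vs H x × Vs H y × x ≢ y)

  _⊆S_ : Subgraph adj → Subgraph adj → Set
  H ⊆S H' = (∀ x → Vs H x → Vs H' x) × (∀ x y → Es H x y → Es H' x y)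

  IsBlob : Subgraph adj → Set
  IsBlob H = IsBridgelessSub H ×
             (∀ H' → IsBridgelessSub H' → H ⊆S H' → H' ⊆S H)

-- Level-k: deleting a set D of edges, with at most k edges from each
-- blob, yields a tree.  "At most k edges of D lie in the blob B" is
-- expressed as: those edges are covered (as unordered pairs) by a list
-- of at most k pairs.

AtMostInBlob : {n : ℕ} {adj : Fin n → Fin n → Bool} →
               ℕ → List (Fin n × Fin n) → Subgraph adj → Set
AtMostInBlob {n} {adj} k D B =
  Σ (List (Fin n × Fin n)) λ L → length L ≤ k ×
    (∀ e → e ∈ D → Es {n} {adj} B (proj₁ e) (proj₂ e) → e ∈ L ⊎ swap e ∈ L)

IsLevel : {n : ℕ} → ℕ → (Fin n → Fin n → Bool) → Set
IsLevel {n} k adj =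
  Σ (List (Fin n × Fin n)) λ D →
    (∀ e → e ∈ D → Edge adj (proj₁ e) (proj₂ e)) ×
    (∀ (B : Subgraph adj) → IsBlob B → AtMostInBlob k D B) ×
    IsTree (removeEdges (Edge adj) D)

-- strictly level-k: level-k but not level-(k-1); every network fails to
-- be level-(-1), so strictly level-0 = level-0.
IsStrictlyLevel : {n : ℕ} → ℕ → (Fin n → Fin n → Bool) → Set
IsStrictlyLevel zero adj = IsLevel zero adj
IsStrictlyLevel (suc k) adj = IsLevel (suc k) adj × ¬ IsLevel k adj

-- A path in the cycle cs is a run of consecutive
-- vertices (cyclically); up to rotating cs it is an initial segment.

rotate : {A : Set} → ℕ → List A → List A
rotate i xs = drop i xs ++ take i xs

IsQCuttable : {n : ℕ} → ℕ → (Fin n → Fin n → Bool) → Set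
IsQCuttable q adj =
  ∀ cs → IsCycle (Edge adj) cs →
    Σ ℕ λ i → q ≤ length cs ×
      All (IncidentToCutEdge adj) (take q (rotate i cs))

{-# OPTIONS --safe #-}
-- For k = 0 a single edge will do.  For k ≥ 1 take a ladder with rungs 0 … k, each rung a path
-- with q inner vertices, and hang a leaf on every inner vertex and on the four corners, so that all
-- degrees are 1 or 3.  The pendant edges are cut-edges and everything else forms one blob, in which
-- every edge lies on a square.  Deleting the k top rails leaves a tree, so the network is level-k.
-- If at most k - 1 blob edges are deleted, then fewer than k of the k + 1 rungs and k rail pairs are
-- hit, so some two unhit rungs have only unhit rail pairs between them, and they bound a surviving
-- cycle.  A cycle avoids the leaves; if it meets an inner vertex it runs along that whole rung, whose
-- q inner vertices carry pendant cut-edges, and otherwise it would stay on the rails, which hold no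
-- cycle.
module Submission where

open import Defs
open import Data.Nat using (ℕ; zero; suc; pred; _≤_; _<_; z≤n; s≤s; _+_; _∸_; _≟_; _<?_; _≤?_; _≡ᵇ_)
open import Data.Nat.Properties using (+-commutativeSemigroup; ≤-totalOrder; ≤-refl; ≤-trans; ≤-pred; ≤-reflexive; ≤-antisym; <-irrefl; ≮⇒≥; ≰⇒>; <⇒≱; n≢0⇒n>0; n≤1+n; ≤∧≢⇒<; m≤n⇒m<n∨m≡n; +-comm; +-suc; +-identityʳ; m≤n+m; +-mono-≤; +-monoʳ-<; ∸-monoʳ-≤; m≤n⇒m∸n≡0; ∸-cancelˡ-≡; m∸n≤m; pred[m∸n]≡m∸[1+n]; +-∸-assoc; m∸[m∸n]≡n; n∸n≡0; m∸n≡0⇒m≤n; m+n≡0⇒m≡0; m+n≡0⇒n≡0; ≤-<-trans; ≡ᵇ⇒≡; ≡⇒≡ᵇ)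
open import Data.Nat.Induction using (<-wellFounded)
open import Data.Nat.ListAction using (sum)
open import Induction.WellFounded using (Acc; acc)
open import Algebra.Properties.CommutativeSemigroup +-commutativeSemigroup using (interchange)
open import Data.Fin using (Fin; zero; suc; toℕ)
open import Data.Fin.Properties using () renaming (_≟_ to _≟ᶠ_)
open import Data.Bool using (Bool; true; false; if_then_else_; _∧_; _∨_; not; T)
open import Data.Bool.Properties using (∧-identityʳ; ∨-comm; ∧-comm)
open import Data.List using (List; []; _∷_; _++_; [_]; length; map; allFin; take; drop; filter; cartesianProduct; upTo; lookup; initLast; _∷ʳ′_)
open import Data.List.Properties using (map-cong; map-++; map-∘; ++-assoc; ++-identityʳ; take-all; drop-all; length-map; length-++-≤ˡ; length-++-≤ʳ; ∷-injective)
import Data.List.Extrema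
open import Data.List.Membership.Propositional using (_∈_; _∉_; find)
open import Data.List.Membership.Propositional.Properties using (∈-∃++; ∈-++⁺ˡ; ∈-++⁺ʳ; ∈-++⁻; ∈-allFin; ∈-map⁺; ∈-map⁻; ∈-filter⁺; ∈-filter⁻; ∈-cartesianProduct⁺; ∈-cartesianProduct⁻; ∈-upTo⁺; ∈-upTo⁻; ∈-lookup)
open import Data.List.Membership.DecPropositional using () renaming (_∈?_ to ∈?-with)
open import Data.List.Relation.Unary.All using (All; []; _∷_)
import Data.List.Relation.Unary.All as All
import Data.List.Relation.Unary.All.Properties as All
open import Data.List.Relation.Unary.All.Properties using (∷ʳ⁺; ¬Any⇒All¬)
open import Data.List.Relation.Unary.Any as Any using (here; there; any?)
open import Data.List.Relation.Unary.Any.Properties using (lookup-index)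
open import Data.List.Relation.Unary.AllPairs using ([]; _∷_)
open import Data.List.Relation.Unary.Unique.Propositional using (Unique)
open import Data.List.Relation.Unary.Unique.Propositional.Properties using (allFin⁺; ++⁺; map⁺; filter⁺; cartesianProduct⁺; upTo⁺)
open import Data.Product using (Σ; ∃-syntax; _×_; _,_; proj₁; proj₂; uncurry; swap)
open import Data.Sum using (_⊎_; inj₁; inj₂) renaming (swap to swap⊎)
open import Data.Empty using (⊥; ⊥-elim)
open import Data.Unit using (⊤; tt)
open import Function using (_∘_)
open import Relation.Nullary using (¬_; Dec; yes; no; does)
open import Relation.Nullary.Decidable using (_×-dec_; _⊎-dec_; map′; dec-true; dec-false)
open import Relation.Binary.Definitions using (DecidableEquality; Symmetric)
open import Relation.Binary.PropositionalEquality using (_≡_; _≢_; refl; sym; trans; cong; cong₂; subst; subst₂; module ≡-Reasoning)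

module _ {n : ℕ} where

  infixr 5 _◅◅_
  _◅◅_ : {R : Rel n} {x y z : Fin n} → Walk R x y → Walk R y z → Walk R x z
  stay _ ◅◅ w = w
  step e p ◅◅ w = step e (p ◅◅ w)

  map-walk : {R S : Rel n} → (∀ {x y} → R x y → S x y) → ∀ {x y} → Walk R x y → Walk S x y
  map-walk f (stay x) = stay x
  map-walk f (step e p) = step (f e) (map-walk f p)

  reverse-walk : {R : Rel n} → Symmetric R → ∀ {x y} → Walk R x y → Walk R y x
  reverse-walk sym-R (stay x) = stay x
  reverse-walk sym-R (step e p) = reverse-walk sym-R p ◅◅ step (sym-R e) (stay _)

  record Descent (R : Rel n) (P : Fin n → Set) (d : Fin n → ℕ) (root : Fin n) : Set where
    field
      zero⇒root : ∀ {x} → P x → d x ≡ 0 → x ≡ root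
      descend   : ∀ {x} → P x → 0 < d x → ∃[ y ] R x y × P y × d y < d x

  module _ {R : Rel n} {P : Fin n → Set} {d : Fin n → ℕ} {root : Fin n} (D : Descent R P d root) where
    open Descent D

    descent-walk : ∀ {x} → P x → Walk R x root
    descent-walk {x} = go (<-wellFounded (d x))
      where
      go : ∀ {x} → Acc _<_ (d x) → P x → Walk R x root
      go {x} (acc rs) px with d x ≟ 0
      ... | yes dx≡0 = subst (λ z → Walk R z root) (sym (zero⇒root px dx≡0)) (stay root)
      ... | no dx≢0 with descend px (n≢0⇒n>0 dx≢0)
      ...   | y , e , py , dy<dx = step e (go (rs dy<dx) py)

    descent-connectedOn : Symmetric R → ConnectedOn P R
    descent-connectedOn sym-R x y px py = descent-walk px ◅◅ reverse-walk sym-R (descent-walk py)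

module _ {A : Set} where

  rotate₁ : List A → List A
  rotate₁ [] = []
  rotate₁ (x ∷ xs) = xs ++ [ x ]

  data Rotation (xs : List A) : List A → Set where
    start : Rotation xs xs
    turn  : ∀ {ys} → Rotation xs ys → Rotation xs (rotate₁ ys)

  length-∷ʳ : ∀ (xs : List A) x → length (xs ++ [ x ]) ≡ suc (length xs)
  length-∷ʳ [] x = refl
  length-∷ʳ (y ∷ xs) x = cong suc (length-∷ʳ xs x)

  length-rotate₁ : ∀ ys → length (rotate₁ ys) ≡ length ys
  length-rotate₁ [] = refl
  length-rotate₁ (x ∷ xs) = length-∷ʳ xs x

  rotation-length : ∀ {xs ys} → Rotation xs ys → length ys ≡ length xs
  rotation-length start = refl
  rotation-length (turn {ys} rot) = trans (length-rotate₁ ys) (rotation-length rot)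

  ∈-rotate₁ : ∀ {y} ys → y ∈ rotate₁ ys → y ∈ ys
  ∈-rotate₁ (x ∷ xs) y∈ with ∈-++⁻ xs y∈
  ... | inj₁ y∈xs = there y∈xs
  ... | inj₂ (here refl) = here refl

  rotation-∈ : ∀ {xs ys y} → Rotation xs ys → y ∈ ys → y ∈ xs
  rotation-∈ start y∈ = y∈
  rotation-∈ (turn {ys} rot) y∈ = rotation-∈ rot (∈-rotate₁ ys y∈)

  rotation-move : ∀ {xs} as u us → Rotation xs (as ++ u ∷ us) → Rotation xs (u ∷ us ++ as)
  rotation-move [] u us rot = subst (Rotation _) (cong (u ∷_) (sym (++-identityʳ us))) rot
  rotation-move (a ∷ as) u us rot =
    subst (Rotation _) (cong (u ∷_) (++-assoc us [ a ] as))
      (rotation-move as u (us ++ [ a ]) (subst (Rotation _) (++-assoc as (u ∷ us) [ a ]) (turn rot)))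

  rotation-to : ∀ {xs ys x} → Rotation xs ys → x ∈ ys → ∃[ zs ] Rotation xs (x ∷ zs)
  rotation-to {x = x} rot x∈ with ∈-∃++ x∈
  ... | as , bs , refl = bs ++ as , rotation-move as x bs rot

  rotate₁-rotate : ∀ i (xs : List A) → i < length xs → rotate₁ (rotate i xs) ≡ rotate (suc i) xs
  rotate₁-rotate i xs i<len with split i xs i<len
    where
    split : ∀ i (xs : List A) → i < length xs → ∃[ y ] ∃[ zs ]
      drop i xs ≡ y ∷ zs × drop (suc i) xs ≡ zs × take (suc i) xs ≡ take i xs ++ [ y ]
    split zero (x ∷ xs) _ = x , xs , refl , refl , refl
    split (suc i) (x ∷ xs) (s≤s i<len) with split i xs i<len
    ... | y , zs , e₁ , e₂ , e₃ = y , zs , e₁ , e₂ , cong (x ∷_) e₃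
  ... | y , zs , e₁ , e₂ , e₃ rewrite e₁ | e₂ | e₃ = ++-assoc zs (take i xs) [ y ]

  rotation-rotate : ∀ {xs ys} → Rotation xs ys → ∃[ i ] ys ≡ rotate i xs
  rotation-rotate {xs} start = 0 , sym (++-identityʳ xs)
  rotation-rotate {xs} (turn rot) with rotation-rotate rot
  ... | i , refl with i <? length xs
  ...   | yes i<len = suc i , rotate₁-rotate i xs i<len
  ...   | no i≮len rewrite drop-all i xs (≮⇒≥ i≮len) | take-all i xs (≮⇒≥ i≮len) = 1 , rotate₁≡rotate1 xs
    where
    rotate₁≡rotate1 : ∀ xs → rotate₁ xs ≡ rotate 1 xs
    rotate₁≡rotate1 [] = refl
    rotate₁≡rotate1 (x ∷ xs) = refl

  Consecutive : A → A → List A → Set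
  Consecutive x y xs = ∃[ as ] ∃[ bs ] xs ≡ as ++ x ∷ y ∷ bs

  split-∷ʳ : ∀ (xs : List A) {h} as {x y} bs → xs ++ [ h ] ≡ as ++ x ∷ y ∷ bs →
    (xs ≡ as ++ [ x ] × y ≡ h) ⊎ ∃[ bs′ ] xs ≡ as ++ x ∷ y ∷ bs′
  split-∷ʳ (x ∷ []) [] bs refl = inj₁ (refl , refl)
  split-∷ʳ (x ∷ x′ ∷ xs) [] bs refl = inj₂ (xs , refl)
  split-∷ʳ [] (a ∷ []) bs ()
  split-∷ʳ [] (a ∷ a′ ∷ as) bs ()
  split-∷ʳ (x ∷ xs) (a ∷ as) bs eq with ∷-injective eq
  ... | refl , eq′ with split-∷ʳ xs as bs eq′
  ...   | inj₁ (e₁ , e₂) = inj₁ (cong (x ∷_) e₁ , e₂)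
  ...   | inj₂ (bs′ , e) = inj₂ (bs′ , cong (x ∷_) e)

take-length-++ : {A : Set} (xs ys : List A) → take (length xs) (xs ++ ys) ≡ xs
take-length-++ [] ys = refl
take-length-++ (x ∷ xs) ys = cong (x ∷_) (take-length-++ xs ys)

consecutive-++ʳ : ∀ {A : Set} {x y : A} ys {zs} → Consecutive x y zs → Consecutive x y (ys ++ zs)
consecutive-++ʳ {x = x} {y} ys (as , bs , refl) = ys ++ as , bs , sym (++-assoc ys as (x ∷ y ∷ bs))

consecutive-∷ʳ : ∀ {A : Set} {x y z : A} xs {zs} → Consecutive x y (xs ++ [ z ]) → Consecutive x y (xs ++ z ∷ zs)
consecutive-∷ʳ {x = x} {y} {z} xs {zs} (as , bs , eq) = as , bs ++ zs , (begin
  xs ++ z ∷ zs            ≡⟨ sym (++-assoc xs [ z ] zs) ⟩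
  (xs ++ [ z ]) ++ zs     ≡⟨ cong (_++ zs) eq ⟩
  (as ++ x ∷ y ∷ bs) ++ zs ≡⟨ ++-assoc as (x ∷ y ∷ bs) zs ⟩
  as ++ x ∷ y ∷ bs ++ zs  ∎)
  where open ≡-Reasoning

module _ {n : ℕ} {R : Rel n} where

  consecRel-++ : ∀ xs {a ys} → ConsecRel R (xs ++ [ a ]) → ConsecRel R (a ∷ ys) → ConsecRel R (xs ++ a ∷ ys)
  consecRel-++ [] _ c = c
  consecRel-++ (x ∷ []) (e , _) c = e , c
  consecRel-++ (x ∷ x′ ∷ xs) (e , c₁) c₂ = e , consecRel-++ (x′ ∷ xs) c₁ c₂

  consecRel-++ʳ : ∀ xs {ys} → ConsecRel R (xs ++ ys) → ConsecRel R ys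
  consecRel-++ʳ [] c = c
  consecRel-++ʳ (x ∷ []) {[]} _ = tt
  consecRel-++ʳ (x ∷ []) {y ∷ ys} (_ , c) = c
  consecRel-++ʳ (x ∷ x′ ∷ xs) (_ , c) = consecRel-++ʳ (x′ ∷ xs) c

  cycle-rotate₁ : ∀ {cs} → IsCycle R cs → IsCycle R (rotate₁ cs)
  cycle-rotate₁ {x ∷ y ∷ rest} (len , x∉ ∷ u , _ , _ , refl , x→y , c) =
    subst (3 ≤_) (sym (length-∷ʳ (y ∷ rest) x)) len ,
    ++⁺ u ([] ∷ []) (λ { (x∈ , here refl) → All.lookup x∉ x∈ refl }) ,
    y , rest ++ [ x ] , refl ,
    subst (ConsecRel R) (sym (++-assoc (y ∷ rest) [ x ] [ y ])) (consecRel-++ (y ∷ rest) c (x→y , tt))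
  cycle-rotate₁ {[]} (() , _)
  cycle-rotate₁ {x ∷ []} (s≤s () , _)

  rotation-cycle : ∀ {cs ys} → IsCycle R cs → Rotation cs ys → IsCycle R ys
  rotation-cycle c start = c
  rotation-cycle c (turn rot) = cycle-rotate₁ (rotation-cycle c rot)

  consecutive-cycle : ∀ {h t x y} → IsCycle R (h ∷ t) → Consecutive x y ((h ∷ t) ++ [ h ]) →
    ∃[ rest ] IsCycle R (x ∷ y ∷ rest)
  consecutive-cycle {h} {t} {x} {y} c (as , bs , eq) with split-∷ʳ (h ∷ t) as bs eq
  ... | inj₂ (bs′ , e) = bs′ ++ as , rotation-cycle c (rotation-move as x (y ∷ bs′) (subst (Rotation _) e start))
  ... | inj₁ (e , refl) with as | e | c
  ...   | [] | refl | (s≤s () , _)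
  ...   | a ∷ as′ | refl | _ = as′ , rotation-cycle c (rotation-move (a ∷ as′) x [] start)

  cycle-mono : ∀ {S : Rel n} → (∀ {x y} → R x y → S x y) → ∀ {cs} → IsCycle R cs → IsCycle S cs
  cycle-mono {S} R⇒S {cs} (len , u , x , rest , refl , c) = len , u , x , rest , refl , mono (cs ++ [ x ]) c
    where
    mono : ∀ xs → ConsecRel R xs → ConsecRel S xs
    mono [] _ = tt
    mono (_ ∷ []) _ = tt
    mono (_ ∷ y ∷ xs) (e , c) = R⇒S e , mono (y ∷ xs) c

  restrict-cycle : ∀ {P : Fin n → Set} {cs} → IsCycle R cs → All P cs → IsCycle (λ x y → R x y × P x × P y) cs
  restrict-cycle {P} {cs} (len , u , x , rest , refl , c) all-P =
    len , u , x , rest , refl , restrict (cs ++ [ x ]) c (∷ʳ⁺ all-P (All.lookup all-P (here refl)))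
    where
    restrict : ∀ xs → ConsecRel R xs → All P xs → ConsecRel (λ x y → R x y × P x × P y) xs
    restrict [] _ _ = tt
    restrict (_ ∷ []) _ _ = tt
    restrict (_ ∷ y ∷ xs) (e , c) (px ∷ py ∷ ps) = (e , px , py) , restrict (y ∷ xs) c (py ∷ ps)

  record CycleView (x : Fin n) (zs : List (Fin n)) : Set where
    constructor cycleView
    field
      y z   : Fin n
      mid   : List (Fin n)
      shape : zs ≡ y ∷ mid ++ [ z ]
      x→y   : R x y
      z→x   : R z x
      y≢z   : y ≢ z

  cycle-view : ∀ {x zs} → IsCycle R (x ∷ zs) → CycleView x zs
  cycle-view {zs = []} (s≤s () , _)
  cycle-view {x} {y ∷ zs} (len , _ ∷ (y∉ ∷ _) , _ , _ , refl , x→y , c) with initLast zs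
  ... | [] with len
  ...   | s≤s (s≤s ())
  cycle-view {x} {y ∷ _} (_ , _ ∷ (y∉ ∷ _) , _ , _ , refl , x→y , c) | mid ∷ʳ′ z =
    cycleView y z mid refl x→y z→x (All.lookup y∉ (∈-++⁺ʳ mid (here refl)))
    where
    z→x : R z x
    z→x = proj₁ (consecRel-++ʳ (y ∷ mid) (subst (ConsecRel R) (++-assoc (y ∷ mid) [ z ] [ x ]) c))

  cycle-neighbours : Symmetric R → ∀ {cs w} → IsCycle R cs → w ∈ cs →
    ∃[ y ] ∃[ z ] R w y × R w z × y ≢ z × y ∈ cs × z ∈ cs
  cycle-neighbours sym-R c w∈ with rotation-to start w∈
  ... | zs , rot with cycle-view (rotation-cycle c rot)
  ...   | cycleView y z mid refl w→y z→w y≢z =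
    y , z , w→y , sym-R z→w , y≢z ,
    rotation-∈ rot (there (here refl)) , rotation-∈ rot (there (∈-++⁺ʳ (y ∷ mid) (here refl)))

  record Layering (d : Fin n → ℕ) : Set where
    field
      adjacent-levels : ∀ {x y} → R x y → d y ≡ suc (d x) ⊎ d x ≡ suc (d y)
      unique-below    : ∀ {x y z} → R x y → R x z → d x ≡ suc (d y) → d x ≡ suc (d z) → y ≡ z

  -- A vertex of maximal level on a cycle would have its two cycle neighbours both one level below it.
  layering-acyclic : Symmetric R → ∀ {d} → Layering d → ∀ cs → ¬ IsCycle R cs
  layering-acyclic sym-R {d} L (c ∷ cs) cyc = top-has-two-below
    where
    open Layering L
    open Data.List.Extrema ≤-totalOrder
    top = argmax d c cs
    top∈ : top ∈ c ∷ cs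
    top∈ with argmax-sel d c cs
    ... | inj₁ top≡c = here top≡c
    ... | inj₂ top∈cs = there top∈cs
    maximal : All (λ w → d w ≤ d top) (c ∷ cs)
    maximal = f[⊥]≤f[argmax] {f = d} c cs ∷ f[xs]≤f[argmax] {f = d} c cs
    below : ∀ {w} → R top w → w ∈ c ∷ cs → d top ≡ suc (d w)
    below e w∈ with adjacent-levels e
    ... | inj₂ up = up
    ... | inj₁ down = ⊥-elim (<-irrefl refl (subst (_≤ d top) down (All.lookup maximal w∈)))
    top-has-two-below : ⊥
    top-has-two-below with cycle-neighbours sym-R cyc top∈
    ... | y , z , top→y , top→z , y≢z , y∈ , z∈ =
      y≢z (unique-below top→y top→z (below top→y y∈) (below top→z z∈))

  cycle-detour : ∀ {a b rest} → IsCycle R (a ∷ b ∷ rest) → Walk (removeEdge R a b) b a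
  cycle-detour {rest = []} (s≤s (s≤s ()) , _)
  cycle-detour {a} {b} {r ∷ rs} (_ , (a≢b ∷ a≢r ∷ a∉) ∷ (b≢r ∷ b∉) ∷ _ , _ , _ , refl , _ , b→r , c) =
    step (b→r , first) (along r rs c (a≢r ∘ sym) (b≢r ∘ sym) a∉ b∉)
    where
    first : ¬ ((b ≡ a × r ≡ b) ⊎ (b ≡ b × r ≡ a))
    first (inj₁ (b≡a , _)) = a≢b (sym b≡a)
    first (inj₂ (_ , r≡a)) = a≢r (sym r≡a)
    avoid : ∀ {p q} → p ≢ a → p ≢ b → ¬ ((p ≡ a × q ≡ b) ⊎ (p ≡ b × q ≡ a))
    avoid p≢a _ (inj₁ (p≡a , _)) = p≢a p≡a
    avoid _ p≢b (inj₂ (p≡b , _)) = p≢b p≡b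
    along : ∀ p ps → ConsecRel R (p ∷ ps ++ [ a ]) → p ≢ a → p ≢ b → All (a ≢_) ps → All (b ≢_) ps →
      Walk (removeEdge R a b) p a
    along p [] (e , _) p≢a p≢b [] [] = step (e , avoid p≢a p≢b) (stay a)
    along p (q ∷ qs) (e , c) p≢a p≢b (a≢q ∷ a∉) (b≢q ∷ b∉) =
      step (e , avoid p≢a p≢b) (along q qs c (a≢q ∘ sym) (b≢q ∘ sym) a∉ b∉)

  module _ {a b : Fin n} where

    removeEdge-sym : Symmetric R → Symmetric (removeEdge R a b)
    removeEdge-sym sym-R (e , ne) = sym-R e , λ
      { (inj₁ (p , q)) → ne (inj₂ (q , p))
      ; (inj₂ (p , q)) → ne (inj₁ (q , p)) }

    reroute : Walk (removeEdge R a b) a b → Walk (removeEdge R a b) b a →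
      ∀ {x y} → Walk R x y → Walk (removeEdge R a b) x y
    reroute ab ba (stay x) = stay x
    reroute ab ba (step {x} {y} e w) with ((x ≟ᶠ a) ×-dec (y ≟ᶠ b)) ⊎-dec ((x ≟ᶠ b) ×-dec (y ≟ᶠ a))
    ... | yes (inj₁ (refl , refl)) = ab ◅◅ reroute ab ba w
    ... | yes (inj₂ (refl , refl)) = ba ◅◅ reroute ab ba w
    ... | no ne = step (e , ne) (reroute ab ba w)

  edges-on-cycles⇒bridgeless : Symmetric R → ∀ {P} → ConnectedOn P R →
    (∀ {a b} → R a b → ∃[ rest ] (IsCycle R (a ∷ b ∷ rest) ⊎ IsCycle R (b ∷ a ∷ rest))) →
    ∀ a b → R a b → ConnectedOn P (removeEdge R a b)
  edges-on-cycles⇒bridgeless sym-R conn on-cycle a b e x y px py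
    = reroute (reverse-walk (removeEdge-sym sym-R) ba) ba (conn x y px py)
    where
    ba : Walk (removeEdge R a b) b a
    ba with on-cycle e
    ... | rest , inj₁ c = cycle-detour c
    ... | rest , inj₂ c = map-walk swap-removed (reverse-walk (removeEdge-sym sym-R) (cycle-detour c))
      where
      swap-removed : ∀ {x y} → removeEdge R b a x y → removeEdge R a b x y
      swap-removed (e , ne) = e , λ { (inj₁ p) → ne (inj₂ p) ; (inj₂ p) → ne (inj₁ p) }

record Pendant {n : ℕ} (adj : Fin n → Fin n → Bool) (ℓ u : Fin n) : Set where
  field
    only-neighbour : ∀ {y} → Edge adj ℓ y → y ≡ u
    distinct       : ℓ ≢ u

module _ {n : ℕ} {adj : Fin n → Fin n → Bool} {ℓ u : Fin n} (pendant : Pendant adj ℓ u) where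
  open Pendant pendant

  pendant-isCutEdge : Edge adj u ℓ → IsCutEdge adj u ℓ
  pendant-isCutEdge e = e , λ conn → stuck (conn ℓ u)
    where
    stuck : ¬ Walk (removeEdge (Edge adj) u ℓ) ℓ u
    stuck (stay _) = distinct refl
    stuck (step (e , ne) _) = ne (inj₂ (refl , only-neighbour e))

  pendant-∉-bridgeless : (H : Subgraph adj) → IsBridgelessSub H → ¬ Vs H ℓ
  pendant-∉-bridgeless H (conn , bridgeless , x₁ , x₂ , x₁∈ , x₂∈ , x₁≢x₂) ℓ∈ = leave other
    where
    open Subgraph H
    other : ∃[ y ] Vs H y × y ≢ ℓ
    other with x₁ ≟ᶠ ℓ
    ... | yes refl = x₂ , x₂∈ , x₁≢x₂ ∘ sym
    ... | no x₁≢ℓ = x₁ , x₁∈ , x₁≢ℓ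
    -- the only way out of ℓ is the edge ℓu, which bridgelessness lets us remove
    leave : ¬ (∃[ y ] Vs H y × y ≢ ℓ)
    leave (y , y∈ , y≢ℓ) with conn ℓ y ℓ∈ y∈
    ... | stay _ = y≢ℓ refl
    ... | step {y = z} e _ with only-neighbour (proj₁ (Esub ℓ z e))
    ...   | refl with bridgeless ℓ u e ℓ u ℓ∈ (proj₂ (proj₂ (Esub ℓ u e)))
    ...     | stay _ = distinct refl
    ...     | step (e′ , ne) _ = ne (inj₁ (refl , only-neighbour (proj₁ (Esub ℓ _ e′))))

  pendant-∉-cycle : Symmetric (Edge adj) → ∀ {cs} → IsCycle (Edge adj) cs → ℓ ∉ cs
  pendant-∉-cycle sym-adj cyc ℓ∈ with cycle-neighbours sym-adj cyc ℓ∈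
  ... | _ , _ , ℓ→y , ℓ→z , y≢z , _ = y≢z (trans (only-neighbour ℓ→y) (sym (only-neighbour ℓ→z)))

indicator : Bool → ℕ
indicator b = if b then 1 else 0

module _ {n : ℕ} where

  count : (Fin n → Bool) → ℕ
  count f = sum (map (indicator ∘ f) (allFin n))

  sum-map-+ : {A : Set} (f g : A → ℕ) (xs : List A) → sum (map (λ w → f w + g w) xs) ≡ sum (map f xs) + sum (map g xs)
  sum-map-+ f g [] = refl
  sum-map-+ f g (x ∷ xs) rewrite sum-map-+ f g xs = interchange (f x) (g x) (sum (map f xs)) (sum (map g xs))

  at : Fin n → Fin n → Bool
  at a w = does (w ≟ᶠ a)

  count-at : ∀ a → count (at a) ≡ 1
  count-at a = once (allFin n) (allFin⁺ n) (∈-allFin a)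
    where
    never : ∀ xs → a ∉ xs → sum (map (indicator ∘ at a) xs) ≡ 0
    never [] _ = refl
    never (x ∷ xs) a∉ with x ≟ᶠ a
    ... | yes refl = ⊥-elim (a∉ (here refl))
    ... | no _ = never xs (a∉ ∘ there)
    once : ∀ xs → Unique xs → a ∈ xs → sum (map (indicator ∘ at a) xs) ≡ 1
    once (x ∷ xs) (x∉ ∷ u) a∈ with x ≟ᶠ a | a∈
    ... | yes refl | _ = cong suc (never xs (λ a∈xs → All.lookup x∉ a∈xs refl))
    ... | no x≢a | here a≡x = ⊥-elim (x≢a (sym a≡x))
    ... | no _ | there a∈xs = once xs u a∈xs

  count-≡-length : ∀ (f : Fin n → Bool) ws → Unique ws →
    (∀ {w} → f w ≡ true → w ∈ ws) → All (λ w → f w ≡ true) ws → count f ≡ length ws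
  count-≡-length f [] _ sound _ = never (allFin n)
    where
    never : ∀ xs → sum (map (indicator ∘ f) xs) ≡ 0
    never [] = refl
    never (x ∷ xs) with f x in fx
    ... | true with () ← sound fx
    ... | false = never xs
  count-≡-length f (a ∷ ws) (a∉ ∷ u) sound (fa ∷ complete) = begin
    count f                                               ≡⟨ cong sum (map-cong split (allFin n)) ⟩
    sum (map (λ w → indicator (at a w) + indicator (f′ w)) (allFin n)) ≡⟨ sum-map-+ _ _ (allFin n) ⟩
    count (at a) + count f′                               ≡⟨ cong₂ _+_ (count-at a) (count-≡-length f′ ws u sound′ complete′) ⟩
    suc (length ws)                                       ∎
    where
    open ≡-Reasoning
    f′ : Fin n → Bool
    f′ w = f w ∧ not (at a w)
    split : ∀ w → indicator (f w) ≡ indicator (does (w ≟ᶠ a)) + indicator (f w ∧ not (does (w ≟ᶠ a)))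
    split w with w ≟ᶠ a
    ... | yes refl rewrite fa = refl
    ... | no _ rewrite ∧-identityʳ (f w) = refl
    sound′ : ∀ {w} → f w ∧ not (does (w ≟ᶠ a)) ≡ true → w ∈ ws
    sound′ {w} f′w with w ≟ᶠ a | f w in fw
    ... | yes _ | true = ⊥-elim (bool-absurd f′w)
      where
      bool-absurd : false ≢ true
      bool-absurd ()
    ... | no w≢a | true with sound fw
    ...   | here w≡a = ⊥-elim (w≢a w≡a)
    ...   | there w∈ws = w∈ws
    keep : ∀ {w} → a ≢ w → f w ≡ true → f w ∧ not (does (w ≟ᶠ a)) ≡ true
    keep {w} a≢w fw with w ≟ᶠ a
    ... | yes w≡a = ⊥-elim (a≢w (sym w≡a))
    ... | no _ rewrite fw = refl
    complete′ : All (λ w → f w ∧ not (does (w ≟ᶠ a)) ≡ true) ws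
    complete′ = All.zipWith (λ (a≢w , fw) → keep a≢w fw) (a∉ , complete)

n≢2+n : ∀ {n : ℕ} → n ≢ suc (suc n)
n≢2+n ()

upFrom : ℕ → ℕ → List ℕ
upFrom a zero = []
upFrom a (suc k) = a ∷ upFrom (suc a) k

length-upFrom : ∀ a k → length (upFrom a k) ≡ k
length-upFrom a zero = refl
length-upFrom a (suc k) = cong suc (length-upFrom (suc a) k)

∈-upFrom⁺ : ∀ {g} a k → a ≤ g → g < k + a → g ∈ upFrom a k
∈-upFrom⁺ a zero a≤g g<a = ⊥-elim (<-irrefl refl (≤-trans g<a a≤g))
∈-upFrom⁺ {g} a (suc k) a≤g g<k+1+a with a ≟ g
... | yes refl = here refl
... | no a≢g = there (∈-upFrom⁺ (suc a) k (≤∧≢⇒< a≤g a≢g) (subst (g <_) (sym (+-suc k a)) g<k+1+a))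

upFrom-pred : ∀ {Q} → 1 ≤ Q → 1 ∷ upFrom 2 (Q ∸ 1) ≡ upFrom 1 Q
upFrom-pred {suc Q} _ = refl

∈-upFrom⁻ : ∀ {x} a k → x ∈ upFrom a k → a ≤ x × x < k + a
∈-upFrom⁻ a (suc k) (here refl) = ≤-refl , s≤s (m≤n+m a k)
∈-upFrom⁻ {x} a (suc k) (there x∈) with ∈-upFrom⁻ (suc a) k x∈
... | a<x , x<k+1+a = ≤-trans (n≤1+n a) a<x , subst (x <_) (+-suc k a) x<k+1+a

downTo : ℕ → ℕ → List ℕ
downTo a zero = []
downTo a (suc k) = suc k + a ∷ downTo a k

∈-downTo⁻ : ∀ {x} a k → x ∈ downTo a k → a < x × x ≤ k + a
∈-downTo⁻ a (suc k) (here refl) = s≤s (m≤n+m a k) , ≤-refl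
∈-downTo⁻ a (suc k) (there x∈) with ∈-downTo⁻ a k x∈
... | a<x , x≤k+a = a<x , ≤-trans x≤k+a (n≤1+n _)

upFrom-unique : ∀ a k → Unique (upFrom a k)
upFrom-unique a zero = []
upFrom-unique a (suc k) =
  All.tabulate (λ a∈ a≡ → <-irrefl a≡ (proj₁ (∈-upFrom⁻ (suc a) k a∈))) ∷ upFrom-unique (suc a) k

downTo-unique : ∀ a k → Unique (downTo a k)
downTo-unique a zero = []
downTo-unique a (suc k) =
  All.tabulate (λ x∈ x≡ → <-irrefl (sym x≡) (s≤s (proj₂ (∈-downTo⁻ a k x∈)))) ∷ downTo-unique a k

module _ {A : Set} (f : ℕ → A) where

  consecutive-upFrom : ∀ a k {g} → a ≤ g → g < k + a → Consecutive (f g) (f (suc g)) (map f (upFrom a k) ++ [ f (k + a) ])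
  consecutive-upFrom a zero a≤g g<a = ⊥-elim (<-irrefl refl (≤-trans g<a a≤g))
  consecutive-upFrom a (suc k) {g} a≤g g<k+1+a with a ≟ g
  ... | yes refl with k
  ...   | zero = [] , [] , refl
  ...   | suc _ = [] , _ , refl
  consecutive-upFrom a (suc k) {g} a≤g g<k+1+a | no a≢g
    with consecutive-upFrom (suc a) k (≤∧≢⇒< a≤g a≢g) (subst (g <_) (sym (+-suc k a)) g<k+1+a)
  ... | as , bs , eq = f a ∷ as , bs , cong (f a ∷_) (trans (cong (λ m → map f (upFrom (suc a) k) ++ [ f m ]) (sym (+-suc k a))) eq)

  consecutive-downTo : ∀ a k {g} → a ≤ g → g < k + a → Consecutive (f (suc g)) (f g) (map f (downTo a k) ++ [ f a ])
  consecutive-downTo a zero a≤g g<a = ⊥-elim (<-irrefl refl (≤-trans g<a a≤g))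
  consecutive-downTo a (suc k) {g} a≤g g<k+1+a with g ≟ k + a
  ... | yes refl with k
  ...   | zero = [] , [] , refl
  ...   | suc _ = [] , _ , refl
  consecutive-downTo a (suc k) {g} a≤g g<k+1+a | no g≢k+a
    with consecutive-downTo a k a≤g (≤∧≢⇒< (≤-pred g<k+1+a) g≢k+a)
  ... | as , bs , eq = f (suc k + a) ∷ as , bs , cong (f (suc k + a) ∷_) eq

module _ {n : ℕ} {R : Rel n} (f : ℕ → Fin n) where

  consecRel-upFrom : ∀ a k → (∀ {g} → a ≤ g → g < k + a → R (f g) (f (suc g))) →
    ConsecRel R (map f (upFrom a k) ++ [ f (k + a) ])
  consecRel-upFrom a zero _ = tt
  consecRel-upFrom a (suc zero) edge = edge ≤-refl ≤-refl , tt
  consecRel-upFrom a (suc (suc k)) edge =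
    edge ≤-refl (s≤s (m≤n+m a (suc k))) ,
    subst (λ m → ConsecRel R (map f (upFrom (suc a) (suc k)) ++ [ f m ])) (+-suc (suc k) a)
      (consecRel-upFrom (suc a) (suc k) λ {g} a<g g<k+1+a → edge (≤-trans (n≤1+n a) a<g) (subst (g <_) (+-suc (suc k) a) g<k+1+a))

  consecRel-downTo : ∀ a k → (∀ {g} → a ≤ g → g < k + a → R (f (suc g)) (f g)) →
    ConsecRel R (map f (downTo a k) ++ [ f a ])
  consecRel-downTo a zero _ = tt
  consecRel-downTo a (suc zero) edge = edge ≤-refl ≤-refl , tt
  consecRel-downTo a (suc (suc k)) edge =
    edge (m≤n+m a (suc k)) ≤-refl ,
    consecRel-downTo a (suc k) λ a≤g g<k+1+a → edge a≤g (≤-trans g<k+1+a (n≤1+n _))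

AtMostOneNeighbour : {n : ℕ} → Rel n → Fin n → Set
AtMostOneNeighbour R w = ∀ {y z} → R w y → R w z → y ≡ z

record InnerPath {n : ℕ} (R : Rel n) (Q : ℕ) (p : ℕ → Fin n) : Set where
  field
    injective        : ∀ {j k} → j ≤ suc Q → k ≤ suc Q → p j ≡ p k → j ≡ k
    inner-neighbours : ∀ {j w} → 1 ≤ j → j ≤ Q → R (p j) w →
                       w ≡ p (pred j) ⊎ w ≡ p (suc j) ⊎ AtMostOneNeighbour R w

reverse-innerPath : ∀ {n} {R : Rel n} {Q p} → InnerPath R Q p → InnerPath R Q (λ k → p (suc Q ∸ k))
reverse-innerPath {R = R} {Q} {p} P = record
  { injective = λ {j} {k} j≤ k≤ eq → ∸-cancelˡ-≡ j≤ k≤ (injective (m∸n≤m (suc Q) j) (m∸n≤m (suc Q) k) eq)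
  ; inner-neighbours = neighbours
  }
  where
  open InnerPath P
  neighbours : ∀ {j w} → 1 ≤ j → j ≤ Q → R (p (suc Q ∸ j)) w →
    w ≡ p (suc Q ∸ pred j) ⊎ w ≡ p (suc Q ∸ suc j) ⊎ AtMostOneNeighbour R w
  neighbours {suc j} _ j<Q e with inner-neighbours (1≤Q∸j j<Q) (m∸n≤m Q j) e
    where
    1≤Q∸j : ∀ {Q j} → suc j ≤ Q → 1 ≤ Q ∸ j
    1≤Q∸j {suc Q} {zero} _ = s≤s z≤n
    1≤Q∸j {suc Q} {suc j} (s≤s le) = 1≤Q∸j le
  ... | inj₁ eq = inj₂ (inj₁ (trans eq (cong p (pred[m∸n]≡m∸[1+n] Q j))))
  ... | inj₂ (inj₁ eq) = inj₁ (trans eq (cong p (sym (+-∸-assoc 1 (≤-trans (n≤1+n j) j<Q)))))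
  ... | inj₂ (inj₂ one) = inj₂ (inj₂ one)

module _ {n : ℕ} {R : Rel n} (sym-R : Symmetric R) {Q : ℕ} {p : ℕ → Fin n} (P : InnerPath R Q p)
         {cs : List (Fin n)} (cyc : IsCycle R cs) where
  open InnerPath P

  cycle-inner-neighbours : ∀ {j w} → 1 ≤ j → j ≤ Q → R (p j) w → w ∈ cs → w ≡ p (pred j) ⊎ w ≡ p (suc j)
  cycle-inner-neighbours 1≤j j≤Q e w∈ with inner-neighbours 1≤j j≤Q e
  ... | inj₁ eq = inj₁ eq
  ... | inj₂ (inj₁ eq) = inj₂ eq
  ... | inj₂ (inj₂ one) with cycle-neighbours sym-R cyc w∈
  ...   | _ , _ , w→y , w→z , y≢z , _ = ⊥-elim (y≢z (one w→y w→z))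

  Heading : ℕ → Set
  Heading j = ∃[ rest ] Rotation cs (p j ∷ p (suc j) ∷ rest)

  heading-back : ∀ j → suc (suc j) ≤ Q → Heading (suc j) → Heading j
  heading-back j j+2≤Q (rest , rot) with cycle-view (rotation-cycle cyc rot)
  ... | cycleView _ z mid refl _ z→x y≢z
      with cycle-inner-neighbours (s≤s z≤n) (≤-trans (n≤1+n _) j+2≤Q) (sym-R z→x)
             (rotation-∈ rot (there (there (∈-++⁺ʳ mid (here refl)))))
  ...   | inj₂ z≡ = ⊥-elim (y≢z (sym z≡))
  ...   | inj₁ refl = p (suc (suc j)) ∷ mid , rotation-move (p (suc j) ∷ p (suc (suc j)) ∷ mid) (p j) [] rot

  heading-start : ∀ j → suc j ≤ Q → Heading j → Heading 0
  heading-start zero _ h = h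
  heading-start (suc j) j+2≤Q h = heading-start j (≤-trans (n≤1+n _) j+2≤Q) (heading-back j j+2≤Q h)

  heading-or-reverse : ∀ {j} → 1 ≤ j → j ≤ Q → p j ∈ cs →
    Heading (pred j) ⊎ ∃[ rest ] Rotation cs (p (suc j) ∷ p j ∷ rest)
  heading-or-reverse {suc j} 1≤j j≤Q pj∈ with rotation-to start pj∈
  ... | zs , rot with cycle-view (rotation-cycle cyc rot)
  ...   | cycleView y z mid refl _ z→x _
        with cycle-inner-neighbours 1≤j j≤Q (sym-R z→x) (rotation-∈ rot (there (∈-++⁺ʳ (y ∷ mid) (here refl))))
  ...     | inj₁ refl = inj₁ (y ∷ mid , rotation-move (p (suc j) ∷ y ∷ mid) (p j) [] rot)
  ...     | inj₂ refl = inj₂ (y ∷ mid , rotation-move (p (suc j) ∷ y ∷ mid) (p (suc (suc j))) [] rot)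

  -- After p t and the inner vertex p (t+1) the cycle must go on to p (t+2): p t is already used.
  continue : ∀ t s → suc t ≤ Q → p 0 ∈ cs → Unique (p t ∷ p (suc t) ∷ s) →
    ConsecRel R (p t ∷ p (suc t) ∷ s ++ [ p 0 ]) → All (_∈ cs) s → (t ≡ 0 → s ≢ []) →
    ∃[ rest ] s ≡ map p (upFrom (suc (suc t)) (Q ∸ suc t)) ++ rest
  continue t s t<Q p0∈ u c s⊆ nonempty with suc (suc t) ≤? Q
  ... | no t+2≰Q rewrite m≤n⇒m∸n≡0 (≮⇒≥ t+2≰Q) = s , refl
  continue t [] t<Q p0∈ u (_ , e , _) s⊆ nonempty | yes t+2≤Q
    with cycle-inner-neighbours (s≤s z≤n) t<Q e p0∈
  ... | inj₁ p0≡pt = ⊥-elim (nonempty (sym (injective z≤n (≤-trans (n≤1+n _) (≤-trans t<Q (n≤1+n _))) p0≡pt)) refl)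
  ... | inj₂ p0≡pt+2 with injective z≤n (≤-trans t+2≤Q (n≤1+n _)) p0≡pt+2
  ...   | ()
  continue t (w ∷ s) t<Q p0∈ ((_ ∷ pt≢w ∷ _) ∷ u) (_ , c@(e , _)) (w∈ ∷ s⊆) _ | yes t+2≤Q
    with cycle-inner-neighbours (s≤s z≤n) t<Q e w∈
  ... | inj₁ refl = ⊥-elim (pt≢w refl)
  ... | inj₂ refl with continue (suc t) s t+2≤Q p0∈ u c s⊆ (λ ())
  ...   | rest , eq = rest , trans (cong (p (suc (suc t)) ∷_) eq)
                               (cong (λ k → map p (upFrom (suc (suc t)) k) ++ rest) (sym (+-∸-assoc 1 t+2≤Q)))

  window : 1 ≤ Q → Heading 0 → ∃[ i ] Q ≤ length cs × take Q (rotate i cs) ≡ map p (upFrom 1 Q)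
  window 1≤Q (s , rot) with rotation-cycle cyc rot
  ... | len , u , _ , _ , refl , consec
      with continue 0 s 1≤Q (rotation-∈ rot (here refl)) u consec
             (All.tabulate (λ w∈ → rotation-∈ rot (there (there w∈))))
             (λ _ s≡[] → too-short (subst (λ s → 3 ≤ length (p 0 ∷ p 1 ∷ s)) s≡[] len))
    where
    too-short : ¬ 3 ≤ 2
    too-short (s≤s (s≤s ()))
  ... | rest , refl with rotation-rotate (turn rot)
  ...   | i , rotated≡ = i , Q≤|cs| , window-take
    where
    W = map p (upFrom 1 Q)
    |W| : length W ≡ Q
    |W| = trans (length-map p (upFrom 1 Q)) (length-upFrom 1 Q)
    rotated : rotate i cs ≡ W ++ rest ++ [ p 0 ]
    rotated = trans (sym rotated≡)
      (trans (++-assoc (p 1 ∷ map p (upFrom 2 (Q ∸ 1))) rest [ p 0 ])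
             (cong (λ ks → map p ks ++ rest ++ [ p 0 ]) (upFrom-pred 1≤Q)))
    Q≤|cs| : Q ≤ length cs
    Q≤|cs| = subst₂ _≤_ |W|
      (trans (cong length (sym rotated)) (trans (cong length (sym rotated≡)) (rotation-length (turn rot))))
      (length-++-≤ˡ W)
    window-take : take Q (rotate i cs) ≡ W
    window-take = trans (cong (take Q) rotated) (subst (λ k → take k (W ++ rest ++ [ p 0 ]) ≡ W) |W| (take-length-++ W _))

InnerVertex : ∀ {n} → ℕ → (ℕ → Fin n) → Fin n → Set
InnerVertex Q p w = ∃[ k ] 1 ≤ k × k ≤ Q × w ≡ p k

inner-path-window : ∀ {n} {R : Rel n} → Symmetric R → ∀ {Q p} → InnerPath R Q p → 1 ≤ Q →
  ∀ {cs} → IsCycle R cs → ∀ {j} → 1 ≤ j → j ≤ Q → p j ∈ cs →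
  ∃[ i ] Q ≤ length cs × All (InnerVertex Q p) (take Q (rotate i cs))
inner-path-window sym-R {Q} {p} P 1≤Q cyc {suc j} 1≤j j≤Q pj∈
  with heading-or-reverse sym-R P cyc 1≤j j≤Q pj∈
... | inj₁ h with window sym-R P cyc 1≤Q (heading-start sym-R P cyc j j≤Q h)
...   | i , Q≤ , eq = i , Q≤ , subst (All _) (sym eq) (All.tabulate inner)
  where
  inner : ∀ {w} → w ∈ map p (upFrom 1 Q) → InnerVertex Q p w
  inner w∈ with ∈-map⁻ p w∈
  ... | k , k∈ , refl with ∈-upFrom⁻ 1 Q k∈
  ...   | 1≤k , k<Q+1 = k , 1≤k , ≤-pred (subst (k <_) (+-comm Q 1) k<Q+1) , refl
inner-path-window sym-R {Q} {p} P 1≤Q {cs} cyc {suc j} 1≤j j≤Q pj∈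
    | inj₂ (rest , rot)
    with window sym-R P′ cyc 1≤Q (heading-start sym-R P′ cyc (Q ∸ suc j) Q∸j≤Q (rest , reversed))
  where
  P′ = reverse-innerPath P
  Q∸j≤Q : suc (Q ∸ suc j) ≤ Q
  Q∸j≤Q = subst (_≤ Q) (+-∸-assoc 1 j≤Q) (m∸n≤m Q j)
  reversed : Rotation cs (p (suc Q ∸ (Q ∸ suc j)) ∷ p (Q ∸ (Q ∸ suc j)) ∷ rest)
  reversed = subst (λ k → Rotation cs (p k ∷ p (Q ∸ (Q ∸ suc j)) ∷ rest)) (sym (+-∸-assoc 1 (m∸n≤m Q (suc j))))
               (subst (λ k → Rotation cs (p (suc k) ∷ p k ∷ rest)) (sym (m∸[m∸n]≡n j≤Q)) rot)
... | i , Q≤ , eq = i , Q≤ , subst (All _) (sym eq) (All.tabulate inner)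
  where
  inner : ∀ {w} → w ∈ map (λ k → p (suc Q ∸ k)) (upFrom 1 Q) → InnerVertex Q p w
  inner w∈ with ∈-map⁻ _ w∈
  ... | k , k∈ , refl with ∈-upFrom⁻ 1 Q k∈
  ...   | 1≤k , k<Q+1 with ≤-pred (subst (k <_) (+-comm Q 1) k<Q+1)
  ...     | k≤Q = suc Q ∸ k , subst (1 ≤_) (sym (+-∸-assoc 1 k≤Q)) (s≤s z≤n) , ∸-monoʳ-≤ (suc Q) 1≤k , refl

twice : ℕ → ℕ
twice zero = zero
twice (suc m) = suc (suc (twice m))

twice-+ : ∀ n → twice n ≡ n + n
twice-+ zero = refl
twice-+ (suc n) = cong suc (trans (cong suc (twice-+ n)) (sym (+-suc n n)))

hits : (ℕ → Bool) → ℕ → ℕ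
hits hit zero = 0
hits hit (suc N) = indicator (hit N) + hits hit N

-- Position twice i stands for rung i, position suc (twice g) for the rails between rungs g and suc g.
module Spans (hit : ℕ → Bool) where

  Unhit : ℕ → Set
  Unhit p = hit p ≡ false

  RailsUnhit : ℕ → ℕ → Set
  RailsUnhit i j = ∀ g → i ≤ g → g < j → Unhit (suc (twice g))

  ClearSpan : ℕ → Set
  ClearSpan m = ∃[ i ] ∃[ j ] i < j × j ≤ m × Unhit (twice i) × Unhit (twice j) × RailsUnhit i j

  OpenSpan : ℕ → Set
  OpenSpan m = ∃[ i ] i ≤ m × Unhit (twice i) × RailsUnhit i m

  hitsUpTo : ℕ → ℕ
  hitsUpTo m = hits hit (suc (twice m))

  extend : ∀ {i m} → RailsUnhit i m → Unhit (suc (twice m)) → RailsUnhit i (suc m)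
  extend rails unhit g i≤g (s≤s g≤m) with m≤n⇒m<n∨m≡n g≤m
  ... | inj₁ g<m = rails g i≤g g<m
  ... | inj₂ refl = unhit

  -- Until a clear span appears, all of rungs 0 … m but possibly one are paid for by hits,
  -- and the exception is an unhit rung whose rails up to rung m are unhit.
  Invariant : ℕ → Set
  Invariant m = ClearSpan m ⊎ suc m ≤ hitsUpTo m ⊎ (m ≤ hitsUpTo m × OpenSpan m)

  invariant : ∀ m → Invariant m
  invariant zero with hit 0 in h₀
  ... | true = inj₂ (inj₁ ≤-refl)
  ... | false = inj₂ (inj₂ (z≤n , 0 , z≤n , h₀ , λ _ _ ()))
  invariant (suc m) with invariant m | hit (suc (twice m)) in hᵍ | hit (suc (suc (twice m))) in hʳ
  ... | inj₁ (i , j , i<j , j≤m , rest) | _ | _ = inj₁ (i , j , i<j , ≤-trans j≤m (n≤1+n m) , rest)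
  ... | inj₂ (inj₁ m<S) | gap | true = inj₂ (inj₁ (s≤s (≤-trans m<S (m≤n+m _ (indicator gap)))))
  ... | inj₂ (inj₁ m<S) | gap | false =
    inj₂ (inj₂ (≤-trans m<S (m≤n+m _ (indicator gap)) , suc m , ≤-refl , hʳ , λ g m<g g<m → ⊥-elim (<⇒≱ g<m m<g)))
  ... | inj₂ (inj₂ (m≤S , i , i≤m , unhit , rails)) | false | false =
    inj₁ (i , suc m , s≤s i≤m , ≤-refl , unhit , hʳ , extend rails hᵍ)
  ... | inj₂ (inj₂ (m≤S , i , i≤m , unhit , rails)) | false | true =
    inj₂ (inj₂ (s≤s m≤S , i , ≤-trans i≤m (n≤1+n m) , unhit , extend rails hᵍ))
  ... | inj₂ (inj₂ (m≤S , _)) | true | false =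
    inj₂ (inj₂ (s≤s m≤S , suc m , ≤-refl , hʳ , λ g m<g g<m → ⊥-elim (<⇒≱ g<m m<g)))
  ... | inj₂ (inj₂ (m≤S , _)) | true | true = inj₂ (inj₁ (s≤s (s≤s m≤S)))

  clear-span : ∀ K → hitsUpTo K < K → ClearSpan K
  clear-span K few with invariant K
  ... | inj₁ span = span
  ... | inj₂ (inj₁ K<S) = ⊥-elim (<⇒≱ few (≤-trans (n≤1+n K) K<S))
  ... | inj₂ (inj₂ (K≤S , _)) = ⊥-elim (<⇒≱ few K≤S)

hits-∨ : ∀ (a b : ℕ → Bool) N → hits (λ p → a p ∨ b p) N ≤ hits a N + hits b N
hits-∨ a b zero = z≤n
hits-∨ a b (suc N) =
  subst (hits (λ p → a p ∨ b p) (suc N) ≤_) (interchange (indicator (a N)) (indicator (b N)) (hits a N) (hits b N))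
  (+-mono-≤ (indicator-∨ (a N) (b N)) (hits-∨ a b N))
  where
  indicator-∨ : ∀ x y → indicator (x ∨ y) ≤ indicator x + indicator y
  indicator-∨ true y = s≤s z≤n
  indicator-∨ false y = ≤-refl

hits-≡ᵇ : ∀ c N → hits (c ≡ᵇ_) N ≤ 1
hits-≡ᵇ c N = proj₂ (go N)
  where
  go : ∀ N → (N ≤ c → hits (c ≡ᵇ_) N ≡ 0) × hits (c ≡ᵇ_) N ≤ 1
  go zero = (λ _ → refl) , z≤n
  go (suc N) with c ≡ᵇ N in c≡ᵇN | go N
  ... | true | below , _ with ≡ᵇ⇒≡ c N (subst T (sym c≡ᵇN) tt)
  ...   | refl = (λ N<N → ⊥-elim (<-irrefl refl N<N)) , ≤-reflexive (cong suc (below ≤-refl))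
  go (suc N) | false | below , ≤1 = (λ N<c → below (≤-trans (n≤1+n N) N<c)) , ≤1

module _ {E : Set} (pos : E → ℕ) where

  occupied : List E → ℕ → Bool
  occupied [] p = false
  occupied (e ∷ L) p = (pos e ≡ᵇ p) ∨ occupied L p

  occupied-∈ : ∀ {e L} → e ∈ L → occupied L (pos e) ≡ true
  occupied-∈ {e} (here refl) with pos e ≡ᵇ pos e in eq
  ... | true = refl
  ... | false = ⊥-elim (subst T eq (≡⇒≡ᵇ (pos e) (pos e) refl))
  occupied-∈ {e} {f ∷ L} (there e∈) with pos f ≡ᵇ pos e
  ... | true = refl
  ... | false = occupied-∈ e∈

  hits-occupied : ∀ L N → hits (occupied L) N ≤ length L
  hits-occupied [] zero = z≤n
  hits-occupied [] (suc N) = hits-occupied [] N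
  hits-occupied (e ∷ L) N = ≤-trans (hits-∨ _ (occupied L) N) (+-mono-≤ (hits-≡ᵇ (pos e) N) (hits-occupied L N))

does⇒witness : {A : Set} (a? : Dec A) → does a? ≡ true → A
does⇒witness (yes a) _ = a

lookup-injective : {A : Set} {xs : List A} → Unique xs → ∀ i j → lookup xs i ≡ lookup xs j → i ≡ j
lookup-injective {xs = x ∷ xs} u zero zero _ = refl
lookup-injective {xs = x ∷ xs} (x∉ ∷ _) zero (suc j) eq = ⊥-elim (All.lookup x∉ (∈-lookup j) eq)
lookup-injective {xs = x ∷ xs} (x∉ ∷ _) (suc i) zero eq = ⊥-elim (All.lookup x∉ (∈-lookup i) (sym eq))
lookup-injective {xs = x ∷ xs} (_ ∷ u) (suc i) (suc j) eq = cong suc (lookup-injective u i j eq)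

map⁺-on : {A B : Set} {P : A → Set} {f : A → B} → (∀ {x y} → P x → P y → f x ≡ f y → x ≡ y) →
  ∀ {xs} → All P xs → Unique xs → Unique (map f xs)
map⁺-on f-inj [] [] = []
map⁺-on {P = P} {f} f-inj (px ∷ pxs) (x∉ ∷ u) = apart px pxs x∉ ∷ map⁺-on f-inj pxs u
  where
  apart : ∀ {x ys} → P x → All P ys → All (x ≢_) ys → All (f x ≢_) (map f ys)
  apart px [] [] = []
  apart px (py ∷ pys) (x≢y ∷ x∉) = (x≢y ∘ f-inj px py) ∷ apart px pys x∉

∈-three : {A : Set} {w a b c : A} → w ≡ a ⊎ w ≡ b ⊎ w ≡ c → w ∈ a ∷ b ∷ c ∷ []
∈-three (inj₁ refl) = here refl
∈-three (inj₂ (inj₁ refl)) = there (here refl)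
∈-three (inj₂ (inj₂ refl)) = there (there (here refl))

module Enumeration {V : Set} (_≟ⱽ_ : DecidableEquality V) {Valid : V → Set} {vs : List V}
                   (unique : Unique vs) (complete : ∀ {v} → Valid v → v ∈ vs) (sound : ∀ {v} → v ∈ vs → Valid v)
                   {v₀ : V} (v₀-valid : Valid v₀) where

  N : ℕ
  N = length vs

  opaque
    decode : Fin N → V
    decode = lookup vs

    encode : V → Fin N
    encode v with ∈?-with _≟ⱽ_ v vs
    ... | yes v∈ = Any.index v∈
    ... | no _ = Any.index (complete v₀-valid)

    decode-encode : ∀ {v} → Valid v → decode (encode v) ≡ v
    decode-encode {v} valid with ∈?-with _≟ⱽ_ v vs
    ... | yes v∈ = sym (lookup-index v∈)
    ... | no v∉ = ⊥-elim (v∉ (complete valid))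

    decode-valid : ∀ x → Valid (decode x)
    decode-valid x = sound (∈-lookup x)

    decode-injective : ∀ {x y} → decode x ≡ decode y → x ≡ y
    decode-injective = lookup-injective unique _ _

    encode-decode : ∀ x → encode (decode x) ≡ x
    encode-decode x = decode-injective (decode-encode (decode-valid x))

    encode-injective : ∀ {u v} → Valid u → Valid v → encode u ≡ encode v → u ≡ v
    encode-injective {u} {v} valid-u valid-v eq =
      trans (sym (decode-encode valid-u)) (trans (cong decode eq) (decode-encode valid-v))

data LadderVertex : Set where
  node leaf : ℕ → ℕ → LadderVertex

node-injective : ∀ {i j i′ j′} → node i j ≡ node i′ j′ → i ≡ i′ × j ≡ j′
node-injective refl = refl , refl

leaf-injective : ∀ {i j i′ j′} → leaf i j ≡ leaf i′ j′ → i ≡ i′ × j ≡ j′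
leaf-injective refl = refl , refl

_≟ⱽ_ : DecidableEquality LadderVertex
node i j ≟ⱽ node i′ j′ = map′ (λ { (refl , refl) → refl }) node-injective ((i ≟ i′) ×-dec (j ≟ j′))
leaf i j ≟ⱽ leaf i′ j′ = map′ (λ { (refl , refl) → refl }) leaf-injective ((i ≟ i′) ×-dec (j ≟ j′))
node _ _ ≟ⱽ leaf _ _ = no λ ()
leaf _ _ ≟ⱽ node _ _ = no λ ()

-- Rungs i = 0 … K are paths node i 0 — node i 1 — ⋯ — node i (suc Q); the rails join consecutive
-- rungs at their ends j = 0 and j = suc Q.  Every inner vertex and the four corners carry a leaf.
module Ladder (K Q : ℕ) (1≤K : 1 ≤ K) (1≤Q : 1 ≤ Q) where

  IsRail : ℕ → Set
  IsRail t = t ≡ 0 ⊎ t ≡ suc Q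

  HasLeaf : ℕ → ℕ → Set
  HasLeaf i j = (1 ≤ j × j ≤ Q) ⊎ ((i ≡ 0 ⊎ i ≡ K) × IsRail j)

  HasLeaf? : ∀ i j → Dec (HasLeaf i j)
  HasLeaf? i j = ((1 ≤? j) ×-dec (j ≤? Q)) ⊎-dec (((i ≟ 0) ⊎-dec (i ≟ K)) ×-dec ((j ≟ 0) ⊎-dec (j ≟ suc Q)))

  hasLeaf-≤ : ∀ {i j} → HasLeaf i j → j ≤ suc Q
  hasLeaf-≤ (inj₁ (_ , j≤Q)) = ≤-trans j≤Q (n≤1+n Q)
  hasLeaf-≤ (inj₂ (_ , inj₁ refl)) = z≤n
  hasLeaf-≤ (inj₂ (_ , inj₂ refl)) = ≤-refl

  data Link : LadderVertex → LadderVertex → Set where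
    rung    : ∀ {i j} → i ≤ K → j ≤ Q → Link (node i j) (node i (suc j))
    rail    : ∀ {i t} → IsRail t → suc i ≤ K → Link (node i t) (node (suc i) t)
    pendant : ∀ {i j} → i ≤ K → HasLeaf i j → Link (node i j) (leaf i j)

  private
    Link′ : LadderVertex → LadderVertex → Set
    Link′ (node i j) (node i′ j′) =
      (i′ ≡ i × j′ ≡ suc j × i ≤ K × j ≤ Q) ⊎ (IsRail j × j′ ≡ j × i′ ≡ suc i × suc i ≤ K)
    Link′ (node i j) (leaf i′ j′) = i′ ≡ i × j′ ≡ j × i ≤ K × HasLeaf i j
    Link′ (leaf _ _) _ = ⊥

    Link′? : ∀ u v → Dec (Link′ u v)
    Link′? (node i j) (node i′ j′) =
      ((i′ ≟ i) ×-dec (j′ ≟ suc j) ×-dec (i ≤? K) ×-dec (j ≤? Q)) ⊎-dec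
      (((j ≟ 0) ⊎-dec (j ≟ suc Q)) ×-dec (j′ ≟ j) ×-dec (i′ ≟ suc i) ×-dec (suc i ≤? K))
    Link′? (node i j) (leaf i′ j′) = (i′ ≟ i) ×-dec (j′ ≟ j) ×-dec (i ≤? K) ×-dec HasLeaf? i j
    Link′? (leaf _ _) _ = no λ ()

    from′ : ∀ {u v} → Link′ u v → Link u v
    from′ {node _ _} {node _ _} (inj₁ (refl , refl , i≤K , j≤Q)) = rung i≤K j≤Q
    from′ {node _ _} {node _ _} (inj₂ (t , refl , refl , i<K)) = rail t i<K
    from′ {node _ _} {leaf _ _} (refl , refl , i≤K , h) = pendant i≤K h

    to′ : ∀ {u v} → Link u v → Link′ u v
    to′ (rung i≤K j≤Q) = inj₁ (refl , refl , i≤K , j≤Q)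
    to′ (rail t i<K) = inj₂ (t , refl , refl , i<K)
    to′ (pendant i≤K h) = refl , refl , i≤K , h

  Adj : LadderVertex → LadderVertex → Set
  Adj u v = Link u v ⊎ Link v u

  Link? : ∀ u v → Dec (Link u v)
  Link? u v = map′ from′ to′ (Link′? u v)

  Adj? : ∀ u v → Dec (Adj u v)
  Adj? u v = Link? u v ⊎-dec Link? v u

  link-irreflexive : ∀ {u v} → Link u v → u ≢ v
  link-irreflexive (rung _ _) eq with () ← proj₂ (node-injective eq)
  link-irreflexive (rail _ _) eq with () ← proj₁ (node-injective eq)
  link-irreflexive (pendant _ _) ()

  Valid : LadderVertex → Set
  Valid (node i j) = i ≤ K × j ≤ suc Q
  Valid (leaf i j) = i ≤ K × HasLeaf i j

  link-valid : ∀ {u v} → Link u v → Valid u × Valid v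
  link-valid (rung i≤K j≤Q) = (i≤K , ≤-trans j≤Q (n≤1+n Q)) , (i≤K , s≤s j≤Q)
  link-valid (rail (inj₁ refl) i<K) = (≤-trans (n≤1+n _) i<K , z≤n) , (i<K , z≤n)
  link-valid (rail (inj₂ refl) i<K) = (≤-trans (n≤1+n _) i<K , ≤-refl) , (i<K , ≤-refl)
  link-valid (pendant i≤K h) = (i≤K , hasLeaf-≤ h) , (i≤K , h)

  adj-valid : ∀ {u v} → Adj u v → Valid u × Valid v
  adj-valid (inj₁ l) = link-valid l
  adj-valid (inj₂ l) = proj₂ (link-valid l) , proj₁ (link-valid l)

  opaque
    grid : List (ℕ × ℕ)
    grid = cartesianProduct (upTo (suc K)) (upTo (suc (suc Q)))

    hasLeaf? : (ij : ℕ × ℕ) → Dec (HasLeaf (proj₁ ij) (proj₂ ij))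
    hasLeaf? (i , j) = HasLeaf? i j

    leaves : List (ℕ × ℕ)
    leaves = filter hasLeaf? grid

    vertices : List LadderVertex
    vertices = map (uncurry node) grid ++ map (uncurry leaf) leaves

    ∈-grid : ∀ {i j} → i ≤ K → j ≤ suc Q → (i , j) ∈ grid
    ∈-grid i≤K j≤ = ∈-cartesianProduct⁺ (∈-upTo⁺ (s≤s i≤K)) (∈-upTo⁺ (s≤s j≤))

    ∈-leaves : ∀ {i j} → Valid (leaf i j) → (i , j) ∈ leaves
    ∈-leaves (i≤K , h) = ∈-filter⁺ hasLeaf? (∈-grid i≤K (hasLeaf-≤ h)) h

    leaves-valid : ∀ {i j} → (i , j) ∈ leaves → Valid (leaf i j)
    leaves-valid {i} {j} ij∈ with ∈-filter⁻ hasLeaf? ij∈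
    ... | ij∈grid , h = ≤-pred (∈-upTo⁻ (proj₁ (∈-cartesianProduct⁻ (upTo (suc K)) (upTo (suc (suc Q))) ij∈grid))) , h

    valid⇒∈ : ∀ {v} → Valid v → v ∈ vertices
    valid⇒∈ {node i j} (i≤K , j≤) = ∈-++⁺ˡ (∈-map⁺ (uncurry node) (∈-grid i≤K j≤))
    valid⇒∈ {leaf i j} valid = ∈-++⁺ʳ (map (uncurry node) grid) (∈-map⁺ (uncurry leaf) (∈-leaves valid))

    ∈⇒valid : ∀ {v} → v ∈ vertices → Valid v
    ∈⇒valid v∈ with ∈-++⁻ (map (uncurry node) grid) v∈
    ... | inj₁ v∈nodes with ∈-map⁻ (uncurry node) v∈nodes
    ...   | (i , j) , ij∈ , refl with ∈-cartesianProduct⁻ (upTo (suc K)) (upTo (suc (suc Q))) ij∈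
    ...     | i∈ , j∈ = ≤-pred (∈-upTo⁻ i∈) , ≤-pred (∈-upTo⁻ j∈)
    ∈⇒valid v∈ | inj₂ v∈leaves with ∈-map⁻ (uncurry leaf) v∈leaves
    ...   | (i , j) , ij∈ , refl = leaves-valid ij∈

    unique-grid : Unique grid
    unique-grid = cartesianProduct⁺ (upTo⁺ (suc K)) (upTo⁺ (suc (suc Q)))

    unique-leaves : Unique leaves
    unique-leaves = filter⁺ hasLeaf? unique-grid

    unique-vertices : Unique vertices
    unique-vertices = ++⁺ (map⁺ uncurry-node-injective unique-grid) (map⁺ uncurry-leaf-injective unique-leaves)
                          (λ { (n∈ , l∈) → disjoint n∈ l∈ })
      where
      uncurry-node-injective : ∀ {x y : ℕ × ℕ} → uncurry node x ≡ uncurry node y → x ≡ y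
      uncurry-node-injective {_ , _} {_ , _} refl = refl
      uncurry-leaf-injective : ∀ {x y : ℕ × ℕ} → uncurry leaf x ≡ uncurry leaf y → x ≡ y
      uncurry-leaf-injective {_ , _} {_ , _} refl = refl
      disjoint : ∀ {v} → v ∈ map (uncurry node) grid → v ∈ map (uncurry leaf) leaves → ⊥
      disjoint n∈ l∈ with ∈-map⁻ (uncurry node) n∈ | ∈-map⁻ (uncurry leaf) l∈
      ... | _ , _ , refl | _ , _ , ()

  open Enumeration _≟ⱽ_ unique-vertices valid⇒∈ ∈⇒valid {node 0 0} (z≤n , z≤n) public

  adj : Fin N → Fin N → Bool
  adj x y = does (Adj? (decode x) (decode y))

  adj-symmetric : ∀ x y → adj x y ≡ adj y x
  adj-symmetric x y = ∨-comm (does (Link? (decode x) (decode y))) (does (Link? (decode y) (decode x)))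

  adj-irreflexive : ∀ x → adj x x ≡ false
  adj-irreflexive x = dec-false (Adj? (decode x) (decode x)) λ
    { (inj₁ l) → link-irreflexive l refl
    ; (inj₂ l) → link-irreflexive l refl }

  edge-sym : Symmetric (Edge adj)
  edge-sym {x} {y} e = trans (adj-symmetric y x) e

  edge⇒adj : ∀ {x y} → Edge adj x y → Adj (decode x) (decode y)
  edge⇒adj {x} {y} = does⇒witness (Adj? (decode x) (decode y))

  decoded-adj⇒edge : ∀ {x v} → Adj (decode x) v → Edge adj x (encode v)
  decoded-adj⇒edge {x} {v} a = dec-true (Adj? (decode x) (decode (encode v)))
    (subst (Adj (decode x)) (sym (decode-encode (proj₂ (adj-valid a)))) a)

  adj⇒edge : ∀ {u v} → Adj u v → Edge adj (encode u) (encode v)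
  adj⇒edge a = decoded-adj⇒edge (subst (λ w → Adj w _) (sym (decode-encode (proj₁ (adj-valid a)))) a)

  deg-by-neighbours : ∀ {u} → Valid u → ∀ ws → Unique ws → (∀ {w} → Adj u w → w ∈ ws) → All (Adj u) ws →
    deg adj (encode u) ≡ length ws
  deg-by-neighbours {u} valid ws u-ws sound complete =
    trans (count-≡-length (adj (encode u)) (map encode ws) unique′ sound′ complete′) (length-map encode ws)
    where
    decode-u : decode (encode u) ≡ u
    decode-u = decode-encode valid
    unique′ : Unique (map encode ws)
    unique′ = map⁺-on encode-injective (All.map (proj₂ ∘ adj-valid) complete) u-ws
    sound′ : ∀ {w} → adj (encode u) w ≡ true → w ∈ map encode ws
    sound′ {w} e = subst (_∈ map encode ws) (encode-decode w)
      (∈-map⁺ encode (sound (subst (λ v → Adj v (decode w)) decode-u (edge⇒adj e))))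
    complete′ : All (λ w → adj (encode u) w ≡ true) (map encode ws)
    complete′ = All.map⁺ (All.map (λ a → decoded-adj⇒edge (subst (λ v → Adj v _) (sym decode-u) a)) complete)

  three-distinct : {A : Set} {a b c : A} → a ≢ b → a ≢ c → b ≢ c → Unique (a ∷ b ∷ c ∷ [])
  three-distinct a≢b a≢c b≢c = (a≢b ∷ a≢c ∷ []) ∷ (b≢c ∷ []) ∷ [] ∷ []

  inner-neighbour : ∀ {i j w} → 1 ≤ j → j ≤ Q → Adj (node i j) w →
    w ≡ node i (pred j) ⊎ w ≡ node i (suc j) ⊎ w ≡ leaf i j
  inner-neighbour _ _ (inj₁ (rung _ _)) = inj₂ (inj₁ refl)
  inner-neighbour _ _ (inj₁ (pendant _ _)) = inj₂ (inj₂ refl)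
  inner-neighbour _ _ (inj₂ (rung _ _)) = inj₁ refl
  inner-neighbour () _ (inj₁ (rail (inj₁ refl) _))
  inner-neighbour _ Q+1≤Q (inj₁ (rail (inj₂ refl) _)) = ⊥-elim (<-irrefl refl Q+1≤Q)
  inner-neighbour () _ (inj₂ (rail (inj₁ refl) _))
  inner-neighbour _ Q+1≤Q (inj₂ (rail (inj₂ refl) _)) = ⊥-elim (<-irrefl refl Q+1≤Q)

  inner-degree : ∀ {i j} → i ≤ K → 1 ≤ j → j ≤ Q → deg adj (encode (node i j)) ≡ 3
  inner-degree {i} {suc j} i≤K 1≤j j≤Q =
    deg-by-neighbours (i≤K , ≤-trans j≤Q (n≤1+n Q)) (node i j ∷ node i (suc (suc j)) ∷ leaf i (suc j) ∷ [])
      (three-distinct (λ ()) (λ ()) (λ ()))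
      (λ a → ∈-three (inner-neighbour 1≤j j≤Q a))
      (inj₂ (rung i≤K (≤-trans (n≤1+n j) j≤Q)) ∷ inj₁ (rung i≤K j≤Q) ∷
       inj₁ (pendant i≤K (inj₁ (1≤j , j≤Q))) ∷ [])

  RailNeighbour : ℕ → ℕ → ℕ → LadderVertex → Set
  RailNeighbour i t a w =
    w ≡ node i a ⊎ (w ≡ node (suc i) t × suc i ≤ K) ⊎
    (∃[ k ] i ≡ suc k × w ≡ node k t) ⊎ (w ≡ leaf i t × HasLeaf i t)

  top-neighbour : ∀ {i w} → Adj (node i 0) w → RailNeighbour i 0 1 w
  top-neighbour (inj₁ (rung _ _)) = inj₁ refl
  top-neighbour (inj₁ (rail _ i<K)) = inj₂ (inj₁ (refl , i<K))
  top-neighbour (inj₁ (pendant _ h)) = inj₂ (inj₂ (inj₂ (refl , h)))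
  top-neighbour (inj₂ (rail _ _)) = inj₂ (inj₂ (inj₁ (_ , refl , refl)))

  bottom-neighbour : ∀ {i w} → Adj (node i (suc Q)) w → RailNeighbour i (suc Q) Q w
  bottom-neighbour (inj₁ (rung _ Q+1≤Q)) = ⊥-elim (<-irrefl refl Q+1≤Q)
  bottom-neighbour (inj₁ (rail _ i<K)) = inj₂ (inj₁ (refl , i<K))
  bottom-neighbour (inj₁ (pendant _ h)) = inj₂ (inj₂ (inj₂ (refl , h)))
  bottom-neighbour (inj₂ (rung _ _)) = inj₁ refl
  bottom-neighbour (inj₂ (rail _ _)) = inj₂ (inj₂ (inj₁ (_ , refl , refl)))

  rail-≤ : ∀ {t} → IsRail t → t ≤ suc Q
  rail-≤ (inj₁ refl) = z≤n
  rail-≤ (inj₂ refl) = ≤-refl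

  rail-not-inner : ∀ {t} → IsRail t → ¬ (1 ≤ t × t ≤ Q)
  rail-not-inner (inj₁ refl) (() , _)
  rail-not-inner (inj₂ refl) (_ , Q+1≤Q) = <-irrefl refl Q+1≤Q

  rail-degree : ∀ {i t a} → i ≤ K → IsRail t → a ≢ t → Adj (node i t) (node i a) →
    (∀ {w} → Adj (node i t) w → RailNeighbour i t a w) → deg adj (encode (node i t)) ≡ 3
  rail-degree {zero} {t} {a} i≤K rail-t a≢t inward neighbour =
    deg-by-neighbours (i≤K , rail-≤ rail-t) (node 0 a ∷ node 1 t ∷ leaf 0 t ∷ [])
      (three-distinct (a≢t ∘ proj₂ ∘ node-injective) (λ ()) (λ ()))
      (λ a → ∈-three (first-corner (neighbour a)))
      (inward ∷ inj₁ (rail rail-t 1≤K) ∷ inj₁ (pendant z≤n (inj₂ (inj₁ refl , rail-t))) ∷ [])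
    where
    first-corner : ∀ {w} → RailNeighbour 0 t a w → w ≡ node 0 a ⊎ w ≡ node 1 t ⊎ w ≡ leaf 0 t
    first-corner (inj₁ eq) = inj₁ eq
    first-corner (inj₂ (inj₁ (eq , _))) = inj₂ (inj₁ eq)
    first-corner (inj₂ (inj₂ (inj₂ (eq , _)))) = inj₂ (inj₂ eq)
  rail-degree {suc k} {t} {a} i≤K rail-t a≢t inward neighbour with suc k ≟ K
  ... | yes refl =
    deg-by-neighbours (i≤K , rail-≤ rail-t) (node (suc k) a ∷ node k t ∷ leaf (suc k) t ∷ [])
      (three-distinct (a≢t ∘ proj₂ ∘ node-injective) (λ ()) (λ ()))
      (λ a → ∈-three (last-corner (neighbour a)))
      (inward ∷ inj₂ (rail rail-t ≤-refl) ∷ inj₁ (pendant i≤K (inj₂ (inj₂ refl , rail-t))) ∷ [])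
    where
    last-corner : ∀ {w} → RailNeighbour (suc k) t a w → w ≡ node (suc k) a ⊎ w ≡ node k t ⊎ w ≡ leaf (suc k) t
    last-corner (inj₁ eq) = inj₁ eq
    last-corner (inj₂ (inj₁ (_ , k+2≤k+1))) = ⊥-elim (<-irrefl refl k+2≤k+1)
    last-corner (inj₂ (inj₂ (inj₁ (_ , refl , eq)))) = inj₂ (inj₁ eq)
    last-corner (inj₂ (inj₂ (inj₂ (eq , _)))) = inj₂ (inj₂ eq)
  ... | no k+1≢K =
    deg-by-neighbours (i≤K , rail-≤ rail-t) (node (suc k) a ∷ node k t ∷ node (suc (suc k)) t ∷ [])
      (three-distinct (a≢t ∘ proj₂ ∘ node-injective) (a≢t ∘ proj₂ ∘ node-injective) (λ ()))
      (λ a → ∈-three (middle (neighbour a)))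
      (inward ∷ inj₂ (rail rail-t i≤K) ∷ inj₁ (rail rail-t (≤∧≢⇒< i≤K k+1≢K)) ∷ [])
    where
    middle : ∀ {w} → RailNeighbour (suc k) t a w → w ≡ node (suc k) a ⊎ w ≡ node k t ⊎ w ≡ node (suc (suc k)) t
    middle (inj₁ eq) = inj₁ eq
    middle (inj₂ (inj₁ (eq , _))) = inj₂ (inj₂ eq)
    middle (inj₂ (inj₂ (inj₁ (_ , refl , eq)))) = inj₂ (inj₁ eq)
    middle (inj₂ (inj₂ (inj₂ (_ , inj₁ inner)))) = ⊥-elim (rail-not-inner rail-t inner)
    middle (inj₂ (inj₂ (inj₂ (_ , inj₂ (inj₁ () , _)))))
    middle (inj₂ (inj₂ (inj₂ (_ , inj₂ (inj₂ k+1≡K , _))))) = ⊥-elim (k+1≢K k+1≡K)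

  leaf-neighbour : ∀ {i j w} → Adj (leaf i j) w → w ≡ node i j
  leaf-neighbour (inj₂ (pendant _ _)) = refl

  node-degree : ∀ {i j} → Valid (node i j) → deg adj (encode (node i j)) ≡ 3
  node-degree {i} {zero} (i≤K , _) =
    rail-degree i≤K (inj₁ refl) (λ ()) (inj₁ (rung i≤K z≤n)) top-neighbour
  node-degree {i} {suc j} (i≤K , j<) with j ≟ Q
  ... | yes refl =
    rail-degree i≤K (inj₂ refl) (λ Q≡Q+1 → <-irrefl Q≡Q+1 ≤-refl) (inj₂ (rung i≤K ≤-refl)) bottom-neighbour
  ... | no j≢Q = inner-degree i≤K (s≤s z≤n) (≤∧≢⇒< (≤-pred j<) j≢Q)

  leaf-degree : ∀ {i j} → Valid (leaf i j) → deg adj (encode (leaf i j)) ≡ 1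
  leaf-degree {i} {j} (i≤K , h) =
    deg-by-neighbours (i≤K , h) (node i j ∷ []) ([] ∷ []) (λ a → here (leaf-neighbour a)) (inj₂ (pendant i≤K h) ∷ [])

  data View : Fin N → Set where
    node-view : ∀ {i j} → Valid (node i j) → View (encode (node i j))
    leaf-view : ∀ {i j} → Valid (leaf i j) → View (encode (leaf i j))

  view : ∀ x → View x
  view x with decode x | decode-valid x | encode-decode x
  ... | node i j | valid | refl = node-view valid
  ... | leaf i j | valid | refl = leaf-view valid

  degree-1-or-3 : ∀ x → deg adj x ≡ 1 ⊎ deg adj x ≡ 3
  degree-1-or-3 x with view x
  ... | node-view valid = inj₂ (node-degree valid)
  ... | leaf-view valid = inj₁ (leaf-degree valid)

  label : Fin (length leaves) → Fin N
  label k = encode (uncurry leaf (lookup leaves k))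

  label-valid : ∀ k → Valid (uncurry leaf (lookup leaves k))
  label-valid k = leaves-valid (∈-lookup k)

  label-injective : ∀ k l → label k ≡ label l → k ≡ l
  label-injective k l eq = lookup-injective unique-leaves k l (uncurry-leaf-injective (encode-injective (label-valid k) (label-valid l) eq))
    where
    uncurry-leaf-injective : ∀ {x y : ℕ × ℕ} → uncurry leaf x ≡ uncurry leaf y → x ≡ y
    uncurry-leaf-injective {_ , _} {_ , _} refl = refl

  label-surjective : ∀ v → deg adj v ≡ 1 → ∃[ k ] label k ≡ v
  label-surjective v deg≡1 with view v
  ... | node-view valid with () ← trans (sym deg≡1) (node-degree valid)
  ... | leaf-view valid with ∈-leaves valid
  ...   | ij∈ = Any.index ij∈ , cong (encode ∘ uncurry leaf) (sym (lookup-index ij∈))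

  column : LadderVertex → ℕ
  column (node i _) = i
  column (leaf i _) = i

  IsNode : LadderVertex → Bool
  IsNode (node _ _) = true
  IsNode (leaf _ _) = false

  core : Subgraph adj
  core = record
    { V    = IsNode ∘ decode
    ; E    = λ x y → adj x y ∧ (IsNode (decode x) ∧ IsNode (decode y))
    ; Esym = λ x y → cong₂ _∧_ (adj-symmetric x y) (∧-comm (IsNode (decode x)) (IsNode (decode y)))
    ; Esub = λ x y e → let a , b = ∧-true (adj x y) _ e in a , ∧-true _ _ b
    }
    where
    ∧-true : ∀ a b → a ∧ b ≡ true → a ≡ true × b ≡ true
    ∧-true true true _ = refl , refl

  CoreEdge : Rel N
  CoreEdge = Es core

  coreEdge-sym : Symmetric CoreEdge
  coreEdge-sym {x} {y} e = trans (Subgraph.Esym core y x) e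

  coreEdge⇒edge : ∀ {x y} → CoreEdge x y → Edge adj x y
  coreEdge⇒edge {x} {y} e = proj₁ (Subgraph.Esub core x y e)

  node-link⇒coreEdge : ∀ {i j i′ j′} → Adj (node i j) (node i′ j′) → CoreEdge (encode (node i j)) (encode (node i′ j′))
  node-link⇒coreEdge {i} {j} {i′} {j′} a
    rewrite adj⇒edge a | decode-encode {node i j} (proj₁ (adj-valid a)) | decode-encode {node i′ j′} (proj₂ (adj-valid a)) = refl

  height : LadderVertex → ℕ
  height (node i j) = i + j
  height (leaf i j) = suc (i + j)

  node∈core : ∀ {i j} → Valid (node i j) → Vs core (encode (node i j))
  node∈core {i} {j} v = cong IsNode (decode-encode {node i j} v)

  height-encode : ∀ {u} → Valid u → height (decode (encode u)) ≡ height u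
  height-encode {u} v = cong height (decode-encode {u} v)

  core-descent : Descent CoreEdge (Vs core) (height ∘ decode) (encode (node 0 0))
  core-descent = record { zero⇒root = zero⇒root ; descend = descend }
    where
    zero⇒root : ∀ {x} → Vs core x → height (decode x) ≡ 0 → x ≡ encode (node 0 0)
    zero⇒root {x} node-x h≡0 with view x
    ... | node-view {zero} {zero} _ = refl
    ... | node-view {zero} {suc j} v rewrite decode-encode {node 0 (suc j)} v with () ← h≡0
    ... | node-view {suc i} {j} v rewrite decode-encode {node (suc i) j} v with () ← h≡0
    ... | leaf-view {i} {j} v rewrite decode-encode {leaf i j} v with () ← node-x
    descend : ∀ {x} → Vs core x → 0 < height (decode x) →
      ∃[ y ] CoreEdge x y × Vs core y × height (decode y) < height (decode x)
    descend {x} node-x h>0 with view x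
    ... | node-view {zero} {zero} v rewrite decode-encode {node 0 0} v with () ← h>0
    ... | node-view {i} {suc j} v@(i≤K , j<) =
      encode (node i j) , node-link⇒coreEdge (inj₂ (rung i≤K (≤-pred j<))) , node∈core (i≤K , ≤-trans (n≤1+n j) j<) ,
      subst₂ _<_ (sym (height-encode (i≤K , ≤-trans (n≤1+n j) j<))) (sym (height-encode v)) (+-monoʳ-< i ≤-refl)
    ... | node-view {suc i} {zero} v@(i<K , _) =
      encode (node i 0) , node-link⇒coreEdge (inj₂ (rail (inj₁ refl) i<K)) , node∈core (≤-trans (n≤1+n i) i<K , z≤n) ,
      subst₂ _<_ (sym (height-encode (≤-trans (n≤1+n i) i<K , z≤n))) (sym (height-encode v)) ≤-refl
    ... | leaf-view {i} {j} v rewrite decode-encode {leaf i j} v with () ← node-x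

  core-connected : ConnectedOn (Vs core) CoreEdge
  core-connected = descent-connectedOn core-descent coreEdge-sym

  walk-to-corner : ∀ x → Walk (Edge adj) x (encode (node 0 0))
  walk-to-corner x with view x
  ... | node-view v = map-walk coreEdge⇒edge (descent-walk core-descent (node∈core v))
  ... | leaf-view (i≤K , h) =
    step (adj⇒edge (inj₂ (pendant i≤K h)))
         (map-walk coreEdge⇒edge (descent-walk core-descent (node∈core (i≤K , hasLeaf-≤ h))))

  connected : Connected (Edge adj)
  connected x y = walk-to-corner x ◅◅ reverse-walk edge-sym (walk-to-corner y)

  isUBN : IsUBN (length leaves) N adj
  isUBN = record
    { nonemptyX  = nonempty (∈-leaves (z≤n , inj₂ (inj₁ refl , inj₁ refl)))
    ; symmetric  = adj-symmetric
    ; irreflex   = adj-irreflexive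
    ; connected  = connected
    ; degree13   = degree-1-or-3
    ; label      = label
    ; label-inj  = label-injective
    ; label-leaf = λ k → leaf-degree (label-valid k)
    ; label-onto = label-surjective
    }
    where
    nonempty : ∀ {x : ℕ × ℕ} {xs} → x ∈ xs → 1 ≤ length xs
    nonempty (here _) = s≤s z≤n
    nonempty (there _) = s≤s z≤n

  leaf-pendant : ∀ {i j} → Valid (leaf i j) → Pendant adj (encode (leaf i j)) (encode (node i j))
  leaf-pendant {i} {j} valid@(i≤K , h) = record { only-neighbour = only-neighbour ; distinct = distinct }
    where
    only-neighbour : ∀ {y} → Edge adj (encode (leaf i j)) y → y ≡ encode (node i j)
    only-neighbour {y} e =
      trans (sym (encode-decode y)) (cong encode (leaf-neighbour (subst (λ w → Adj w (decode y)) (decode-encode valid) (edge⇒adj e))))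
    distinct : encode (leaf i j) ≢ encode (node i j)
    distinct eq with () ← encode-injective valid (i≤K , hasLeaf-≤ h) eq

module LadderCycles (K Q : ℕ) (1≤K : 1 ≤ K) (1≤Q : 1 ≤ Q) where
  open Ladder K Q 1≤K 1≤Q

  -- Oriented edges of the cycle that runs right along the top rail from rung i to rung J,
  -- down rung J, back along the bottom rail and up rung i.
  data CycleEdge (i J : ℕ) : LadderVertex → LadderVertex → Set where
    top    : ∀ {g} → i ≤ g → g < J → CycleEdge i J (node g 0) (node (suc g) 0)
    far    : ∀ {t} → t ≤ Q → CycleEdge i J (node J t) (node J (suc t))
    bottom : ∀ {g} → i ≤ g → g < J → CycleEdge i J (node (suc g) (suc Q)) (node g (suc Q))
    near   : ∀ {t} → t ≤ Q → CycleEdge i J (node i (suc t)) (node i t)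

  cycleEdge-adj : ∀ {i J u v} → i ≤ J → J ≤ K → CycleEdge i J u v → Adj u v
  cycleEdge-adj _ J≤K (top _ g<J) = inj₁ (rail (inj₁ refl) (≤-trans g<J J≤K))
  cycleEdge-adj _ J≤K (far t≤Q) = inj₁ (rung J≤K t≤Q)
  cycleEdge-adj _ J≤K (bottom _ g<J) = inj₂ (rail (inj₂ refl) (≤-trans g<J J≤K))
  cycleEdge-adj i≤J J≤K (near t≤Q) = inj₂ (rung (≤-trans i≤J J≤K) t≤Q)

  module _ (i d : ℕ) where

    private
      J = suc d + i

    topPath farPath bottomPath nearPath : List LadderVertex
    topPath    = map (λ g → node g 0) (upFrom i (suc d))
    farPath    = map (node J) (upFrom 0 (suc Q))
    bottomPath = map (λ g → node g (suc Q)) (downTo i (suc d))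
    nearPath   = map (node i) (downTo 0 (suc Q))

    topSegment farSegment bottomSegment nearSegment ladderCycle : List (Fin N)
    topSegment    = map (λ g → encode (node g 0)) (upFrom i (suc d))
    farSegment    = map (encode ∘ node J) (upFrom 0 (suc Q))
    bottomSegment = map (λ g → encode (node g (suc Q))) (downTo i (suc d))
    nearSegment   = map (encode ∘ node i) (downTo 0 (suc Q))
    ladderCycle   = topSegment ++ farSegment ++ bottomSegment ++ nearSegment

    private
      ∈-upFrom-map : ∀ {A : Set} {h : ℕ → A} {v} a k → v ∈ map h (upFrom a k) → ∃[ g ] a ≤ g × g < k + a × v ≡ h g
      ∈-upFrom-map a k v∈ with ∈-map⁻ _ v∈
      ... | g , g∈ , refl = g , ∈-upFrom⁻ a k g∈ .proj₁ , ∈-upFrom⁻ a k g∈ .proj₂ , refl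

      ∈-downTo-map : ∀ {A : Set} {h : ℕ → A} {v} a k → v ∈ map h (downTo a k) → ∃[ g ] a < g × g ≤ k + a × v ≡ h g
      ∈-downTo-map a k v∈ with ∈-map⁻ _ v∈
      ... | g , g∈ , refl = g , ∈-downTo⁻ a k g∈ .proj₁ , ∈-downTo⁻ a k g∈ .proj₂ , refl

    cyclePath : List LadderVertex
    cyclePath = topPath ++ farPath ++ bottomPath ++ nearPath

    cyclePath-unique : Unique cyclePath
    cyclePath-unique =
      ++⁺ (map⁺ (proj₁ ∘ node-injective) (upFrom-unique i (suc d)))
          (++⁺ (map⁺ (proj₂ ∘ node-injective) (upFrom-unique 0 (suc Q)))
               (++⁺ (map⁺ (proj₁ ∘ node-injective) (downTo-unique i (suc d)))
                    (map⁺ (proj₂ ∘ node-injective) (downTo-unique 0 (suc Q)))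
                    (λ (∈b , ∈n) → bottom∩near ∈b ∈n))
               (λ (∈f , ∈bn) → far∩ ∈f (∈-++⁻ bottomPath ∈bn)))
          (λ (∈t , ∈fbn) → top∩ ∈t (∈-++⁻ farPath ∈fbn))
      where
      bottom∩near : ∀ {v} → v ∈ bottomPath → v ∈ nearPath → ⊥
      bottom∩near ∈b ∈n with ∈-downTo-map i (suc d) ∈b | ∈-downTo-map 0 (suc Q) ∈n
      ... | g , i<g , _ , refl | _ , _ , _ , eq = <-irrefl (sym (proj₁ (node-injective eq))) i<g
      far∩ : ∀ {v} → v ∈ farPath → v ∈ bottomPath ⊎ v ∈ nearPath → ⊥
      far∩ ∈f ∈bn with ∈-upFrom-map 0 (suc Q) ∈f
      far∩ ∈f (inj₁ ∈b) | t , _ , t<Q+1 , refl with ∈-downTo-map i (suc d) ∈b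
      ... | _ , _ , _ , eq = <-irrefl (proj₂ (node-injective eq)) (subst (t <_) (+-identityʳ _) t<Q+1)
      far∩ ∈f (inj₂ ∈n) | t , _ , _ , refl with ∈-downTo-map 0 (suc Q) ∈n
      ... | _ , _ , _ , eq = <-irrefl (sym (proj₁ (node-injective eq))) (s≤s (m≤n+m i d))
      top∩ : ∀ {v} → v ∈ topPath → v ∈ farPath ⊎ v ∈ bottomPath ++ nearPath → ⊥
      top∩ ∈t ∈rest with ∈-upFrom-map i (suc d) ∈t
      top∩ ∈t (inj₁ ∈f) | g , _ , g<J , refl with ∈-upFrom-map 0 (suc Q) ∈f
      ... | _ , _ , _ , eq = <-irrefl (proj₁ (node-injective eq)) g<J
      top∩ ∈t (inj₂ ∈bn) | g , _ , _ , refl with ∈-++⁻ bottomPath ∈bn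
      ... | inj₁ ∈b with ∈-downTo-map i (suc d) ∈b
      ...   | _ , _ , _ , ()
      top∩ ∈t (inj₂ ∈bn) | g , _ , _ , refl | inj₂ ∈n with ∈-downTo-map 0 (suc Q) ∈n
      ...   | _ , 0<t , _ , eq = <-irrefl (proj₂ (node-injective eq)) 0<t

    cyclePath-valid : suc d + i ≤ K → All Valid cyclePath
    cyclePath-valid J≤K = All.tabulate valid
      where
      i≤K : i ≤ K
      i≤K = ≤-trans (m≤n+m i (suc d)) J≤K
      valid : ∀ {v} → v ∈ cyclePath → Valid v
      valid ∈c with ∈-++⁻ topPath ∈c
      ... | inj₁ ∈t with ∈-upFrom-map i (suc d) ∈t
      ...   | g , _ , g<J , refl = ≤-trans (n≤1+n g) (≤-trans g<J J≤K) , z≤n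
      valid ∈c | inj₂ ∈fbn with ∈-++⁻ farPath ∈fbn
      ... | inj₁ ∈f with ∈-upFrom-map 0 (suc Q) ∈f
      ...   | t , _ , t<Q+1 , refl = J≤K , ≤-trans (n≤1+n t) (subst (t <_) (+-identityʳ _) t<Q+1)
      valid ∈c | inj₂ ∈fbn | inj₂ ∈bn with ∈-++⁻ bottomPath ∈bn
      ... | inj₁ ∈b with ∈-downTo-map i (suc d) ∈b
      ...   | g , _ , g≤J , refl = ≤-trans g≤J J≤K , ≤-refl
      valid ∈c | inj₂ ∈fbn | inj₂ ∈bn | inj₂ ∈n with ∈-downTo-map 0 (suc Q) ∈n
      ...   | t , _ , t≤Q+1 , refl = i≤K , subst (t ≤_) (+-identityʳ _) t≤Q+1

    ladderCycle-path : ladderCycle ≡ map encode cyclePath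
    ladderCycle-path = trans
      (cong₂ _++_ (map-∘ (upFrom i (suc d)))
        (cong₂ _++_ (map-∘ (upFrom 0 (suc Q)))
          (cong₂ _++_ (map-∘ (downTo i (suc d))) (map-∘ (downTo 0 (suc Q))))))
      (sym (trans (map-++ encode topPath _)
        (cong (map encode topPath ++_) (trans (map-++ encode farPath _)
          (cong (map encode farPath ++_) (map-++ encode bottomPath nearPath))))))

    ladderCycle-closed : ladderCycle ++ [ encode (node i 0) ] ≡
                         topSegment ++ farSegment ++ bottomSegment ++ nearSegment ++ [ encode (node i 0) ]
    ladderCycle-closed = trans (++-assoc topSegment _ _)
      (cong (topSegment ++_) (trans (++-assoc farSegment _ _)
        (cong (farSegment ++_) (++-assoc bottomSegment nearSegment _))))

    ladderCycle-isCycle : suc d + i ≤ K → (R : Rel N) →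
      (∀ {u v} → CycleEdge i J u v → R (encode u) (encode v)) → IsCycle R ladderCycle
    ladderCycle-isCycle J≤K R edge =
      three≤ (encode (node i 0)) (encode (node J 0)) (encode (node J (suc Q)))
        (map (λ g → encode (node g 0)) (upFrom (suc i) d)) (map (encode ∘ node J) (upFrom 1 Q))
        (map (λ g → encode (node g (suc Q))) (downTo i d)) nearSegment ,
      subst Unique (sym ladderCycle-path) (map⁺-on encode-injective (cyclePath-valid J≤K) cyclePath-unique) ,
      encode (node i 0) , _ , refl ,
      subst (ConsecRel R) (sym ladderCycle-closed)
        (consecRel-++ topSegment top-edges (consecRel-++ farSegment far-edges (consecRel-++ bottomSegment bottom-edges near-edges)))
      where
      three≤ : ∀ {X : Set} (x y z : X) xs ys zs ws → 3 ≤ length ((x ∷ xs) ++ (y ∷ ys) ++ (z ∷ zs) ++ ws)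
      three≤ x y z xs ys zs ws = s≤s (≤-trans
        (s≤s (≤-trans (s≤s z≤n) (length-++-≤ʳ (z ∷ zs ++ ws) {ys})))
        (length-++-≤ʳ (y ∷ ys ++ z ∷ zs ++ ws) {xs}))
      rung-bound : ∀ {t} → t < suc Q + 0 → t ≤ Q
      rung-bound {t} t< = ≤-pred (subst (t <_) (+-identityʳ (suc Q)) t<)
      top-edges : ConsecRel R (topSegment ++ [ encode (node J 0) ])
      top-edges = consecRel-upFrom (λ g → encode (node g 0)) i (suc d) λ i≤g g<J → edge (top i≤g g<J)
      far-edges : ConsecRel R (farSegment ++ [ encode (node J (suc Q)) ])
      far-edges = subst (λ m → ConsecRel R (farSegment ++ [ encode (node J m) ])) (+-identityʳ (suc Q))
        (consecRel-upFrom (encode ∘ node J) 0 (suc Q) λ _ t< → edge (far (rung-bound t<)))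
      bottom-edges : ConsecRel R (bottomSegment ++ [ encode (node i (suc Q + 0)) ])
      bottom-edges = subst (λ m → ConsecRel R (bottomSegment ++ [ encode (node i m) ])) (sym (+-identityʳ (suc Q)))
        (consecRel-downTo (λ g → encode (node g (suc Q))) i (suc d) λ i≤g g<J → edge (bottom i≤g g<J))
      near-edges : ConsecRel R (nearSegment ++ [ encode (node i 0) ])
      near-edges = consecRel-downTo (encode ∘ node i) 0 (suc Q) λ _ t< → edge (near (rung-bound t<))

    cycleEdge-consecutive : ∀ {u v} → CycleEdge i J u v → Consecutive (encode u) (encode v) (ladderCycle ++ [ encode (node i 0) ])
    cycleEdge-consecutive e = subst (Consecutive _ _) (sym ladderCycle-closed) (on-closed-walk e)
      where
      on-closed-walk : ∀ {u v} → CycleEdge i J u v →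
        Consecutive (encode u) (encode v) (topSegment ++ farSegment ++ bottomSegment ++ nearSegment ++ [ encode (node i 0) ])
      on-closed-walk (top i≤g g<J) =
        consecutive-∷ʳ topSegment (consecutive-upFrom (λ g → encode (node g 0)) i (suc d) i≤g g<J)
      on-closed-walk (far {t} t≤Q) =
        consecutive-++ʳ topSegment (consecutive-∷ʳ farSegment
          (subst (λ m → Consecutive (encode (node J t)) (encode (node J (suc t))) (farSegment ++ [ encode (node J m) ]))
                 (+-identityʳ (suc Q))
            (consecutive-upFrom (encode ∘ node J) 0 (suc Q) z≤n (subst (t <_) (sym (+-identityʳ (suc Q))) (s≤s t≤Q)))))
      on-closed-walk (bottom {g} i≤g g<J) =
        consecutive-++ʳ topSegment (consecutive-++ʳ farSegment (consecutive-∷ʳ bottomSegment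
          (subst (λ m → Consecutive (encode (node (suc g) (suc Q))) (encode (node g (suc Q))) (bottomSegment ++ [ encode (node i m) ]))
                 (sym (+-identityʳ (suc Q)))
            (consecutive-downTo (λ g → encode (node g (suc Q))) i (suc d) i≤g g<J))))
      on-closed-walk (near {t} t≤Q) =
        consecutive-++ʳ topSegment (consecutive-++ʳ farSegment (consecutive-++ʳ bottomSegment
          (consecutive-downTo (encode ∘ node i) 0 (suc Q) z≤n (subst (t <_) (sym (+-identityʳ (suc Q))) (s≤s t≤Q)))))

  cycleEdge-core : ∀ {i J u v} → i ≤ J → J ≤ K → CycleEdge i J u v → CoreEdge (encode u) (encode v)
  cycleEdge-core i≤J J≤K e@(top _ _) = node-link⇒coreEdge (cycleEdge-adj i≤J J≤K e)
  cycleEdge-core i≤J J≤K e@(far _) = node-link⇒coreEdge (cycleEdge-adj i≤J J≤K e)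
  cycleEdge-core i≤J J≤K e@(bottom _ _) = node-link⇒coreEdge (cycleEdge-adj i≤J J≤K e)
  cycleEdge-core i≤J J≤K e@(near _) = node-link⇒coreEdge (cycleEdge-adj i≤J J≤K e)

  SquareEdge : ℕ → LadderVertex → LadderVertex → Set
  SquareEdge s = CycleEdge s (suc s)

  link-on-square : ∀ {i j v} → Link (node i j) v → IsNode v ≡ true →
    ∃[ s ] suc s ≤ K × (SquareEdge s (node i j) v ⊎ SquareEdge s v (node i j))
  link-on-square {zero} (rung _ t≤Q) _ = 0 , 1≤K , inj₂ (near t≤Q)
  link-on-square {suc k} (rung k<K t≤Q) _ with suc k ≟ K
  ... | yes refl = k , ≤-refl , inj₁ (far t≤Q)
  ... | no k+1≢K = suc k , ≤∧≢⇒< k<K k+1≢K , inj₂ (near t≤Q)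
  link-on-square (rail (inj₁ refl) i<K) _ = _ , i<K , inj₁ (top ≤-refl ≤-refl)
  link-on-square (rail (inj₂ refl) i<K) _ = _ , i<K , inj₂ (bottom ≤-refl ≤-refl)

  square-cycle : ∀ {s u v} → suc s ≤ K → SquareEdge s u v → ∃[ rest ] IsCycle CoreEdge (encode u ∷ encode v ∷ rest)
  square-cycle {s} s<K e =
    consecutive-cycle (ladderCycle-isCycle s 0 s<K CoreEdge (cycleEdge-core (n≤1+n s) s<K)) (cycleEdge-consecutive s 0 e)

  core-edge-on-cycle : ∀ {a b} → CoreEdge a b →
    ∃[ rest ] (IsCycle CoreEdge (a ∷ b ∷ rest) ⊎ IsCycle CoreEdge (b ∷ a ∷ rest))
  core-edge-on-cycle {a} {b} e with view a | view b | Subgraph.Esub core a b e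
  ... | leaf-view va | _ | _ , a∈ , _ with () ← trans (sym (cong IsNode (decode-encode va))) a∈
  ... | node-view _ | leaf-view vb | _ , _ , b∈ with () ← trans (sym (cong IsNode (decode-encode vb))) b∈
  ... | node-view va | node-view vb | ab , _ with subst₂ Adj (decode-encode va) (decode-encode vb) (edge⇒adj ab)
  ...   | inj₁ l with link-on-square l refl
  ...     | _ , s<K , inj₁ sq = let rest , c = square-cycle s<K sq in rest , inj₁ c
  ...     | _ , s<K , inj₂ sq = let rest , c = square-cycle s<K sq in rest , inj₂ c
  core-edge-on-cycle e | node-view va | node-view vb | ab , _ | inj₂ l with link-on-square l refl
  ...     | _ , s<K , inj₁ sq = let rest , c = square-cycle s<K sq in rest , inj₂ c
  ...     | _ , s<K , inj₂ sq = let rest , c = square-cycle s<K sq in rest , inj₁ c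

  core-isBlob : IsBlob core
  core-isBlob = (core-connected , edges-on-cycles⇒bridgeless coreEdge-sym core-connected core-edge-on-cycle , two-nodes) , maximal
    where
    two-nodes : ∃[ x ] ∃[ y ] Vs core x × Vs core y × x ≢ y
    two-nodes = encode (node 0 0) , encode (node 0 1) , node∈core (z≤n , z≤n) , node∈core (z≤n , s≤s z≤n) ,
                λ eq → 0≢1 (encode-injective (z≤n , z≤n) (z≤n , s≤s z≤n) eq)
      where
      0≢1 : node 0 0 ≢ node 0 1
      0≢1 ()
    maximal : ∀ H → IsBridgelessSub H → core ⊆S H → H ⊆S core
    maximal H bridgeless _ = vertices-in-core , edges
      where
      open Subgraph
      vertices-in-core : ∀ x → Vs H x → Vs core x
      vertices-in-core x x∈ with view x
      ... | node-view valid = node∈core valid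
      ... | leaf-view valid = ⊥-elim (pendant-∉-bridgeless (leaf-pendant valid) H bridgeless x∈)
      edges : ∀ x y → Es H x y → Es core x y
      edges x y e with Esub H x y e
      ... | xy , x∈ , y∈ rewrite xy | vertices-in-core x x∈ | vertices-in-core y y∈ = refl

module LadderQCut (K Q : ℕ) (1≤K : 1 ≤ K) (1≤Q : 1 ≤ Q) where
  open Ladder K Q 1≤K 1≤Q

  IsInner : LadderVertex → Set
  IsInner (node _ j) = 1 ≤ j × j ≤ Q
  IsInner (leaf _ _) = ⊥

  IsInner? : ∀ v → Dec (IsInner v)
  IsInner? (node _ j) = (1 ≤? j) ×-dec (j ≤? Q)
  IsInner? (leaf _ _) = no λ ()

  inner-cut : ∀ {i k} → i ≤ K → 1 ≤ k → k ≤ Q → IncidentToCutEdge adj (encode (node i k))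
  inner-cut i≤K 1≤k k≤Q =
    _ , pendant-isCutEdge (leaf-pendant (i≤K , inj₁ (1≤k , k≤Q))) (adj⇒edge (inj₁ (pendant i≤K (inj₁ (1≤k , k≤Q)))))

  rung-innerPath : ∀ {i} → i ≤ K → InnerPath (Edge adj) Q (λ k → encode (node i k))
  rung-innerPath {i} i≤K = record
    { injective = λ j≤ k≤ eq → proj₂ (node-injective (encode-injective (i≤K , j≤) (i≤K , k≤) eq))
    ; inner-neighbours = neighbours
    }
    where
    neighbours : ∀ {j w} → 1 ≤ j → j ≤ Q → Edge adj (encode (node i j)) w →
      w ≡ encode (node i (pred j)) ⊎ w ≡ encode (node i (suc j)) ⊎ AtMostOneNeighbour (Edge adj) w
    neighbours {j} {w} 1≤j j≤Q e
      with inner-neighbour 1≤j j≤Q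
             (subst (λ v → Adj v (decode w)) (decode-encode (i≤K , ≤-trans j≤Q (n≤1+n Q))) (edge⇒adj e))
    ... | inj₁ eq = inj₁ (trans (sym (encode-decode w)) (cong encode eq))
    ... | inj₂ (inj₁ eq) = inj₂ (inj₁ (trans (sym (encode-decode w)) (cong encode eq)))
    ... | inj₂ (inj₂ eq) = inj₂ (inj₂ (subst (AtMostOneNeighbour (Edge adj)) (sym (trans (sym (encode-decode w)) (cong encode eq)))
                                   λ e₁ e₂ → trans (only-neighbour e₁) (sym (only-neighbour e₂))))
      where open Pendant (leaf-pendant (i≤K , inj₁ (1≤j , j≤Q)))

  IsRailNode : LadderVertex → Set
  IsRailNode (node _ t) = IsRail t
  IsRailNode (leaf _ _) = ⊥

  below : LadderVertex → LadderVertex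
  below (node i t) = node (pred i) t
  below (leaf i t) = leaf i t

  rail-adj : ∀ {u v} → Adj u v → IsRailNode u → IsRailNode v →
    (column v ≡ suc (column u)) ⊎ (column u ≡ suc (column v) × v ≡ below u)
  rail-adj (inj₁ (rung _ _)) (inj₁ refl) (inj₂ 1≡Q+1) with () ← <-irrefl (cong pred 1≡Q+1) 1≤Q
  rail-adj (inj₁ (rung _ Q+1≤Q)) (inj₂ refl) _ = ⊥-elim (<-irrefl refl Q+1≤Q)
  rail-adj (inj₂ (rung _ _)) (inj₂ 1≡Q+1) (inj₁ refl) with () ← <-irrefl (cong pred 1≡Q+1) 1≤Q
  rail-adj (inj₂ (rung _ Q+1≤Q)) _ (inj₂ refl) = ⊥-elim (<-irrefl refl Q+1≤Q)
  rail-adj (inj₁ (rail _ _)) _ _ = inj₁ refl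
  rail-adj (inj₂ (rail _ _)) _ _ = inj₂ (refl , refl)

  RailEdge : Rel N
  RailEdge x y = Edge adj x y × IsRailNode (decode x) × IsRailNode (decode y)

  railEdge-sym : Symmetric RailEdge
  railEdge-sym (e , rx , ry) = edge-sym e , ry , rx

  rail-layering : Layering {R = RailEdge} (column ∘ decode)
  rail-layering = record { adjacent-levels = adjacent-levels ; unique-below = unique-below }
    where
    adjacent-levels : ∀ {x y} → RailEdge x y →
      column (decode y) ≡ suc (column (decode x)) ⊎ column (decode x) ≡ suc (column (decode y))
    adjacent-levels (e , rx , ry) with rail-adj (edge⇒adj e) rx ry
    ... | inj₁ up = inj₁ up
    ... | inj₂ (down , _) = inj₂ down
    is-below : ∀ {x y} → RailEdge x y → column (decode x) ≡ suc (column (decode y)) → decode y ≡ below (decode x)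
    is-below (e , rx , ry) down with rail-adj (edge⇒adj e) rx ry
    ... | inj₂ (_ , y≡) = y≡
    ... | inj₁ up = ⊥-elim (n≢2+n (trans down (cong suc up)))
    unique-below : ∀ {x y z} → RailEdge x y → RailEdge x z →
      column (decode x) ≡ suc (column (decode y)) → column (decode x) ≡ suc (column (decode z)) → y ≡ z
    unique-below x→y x→z y-below z-below = decode-injective (trans (is-below x→y y-below) (sym (is-below x→z z-below)))

  not-inner-rail : ∀ {t} → t ≤ suc Q → ¬ (1 ≤ t × t ≤ Q) → IsRail t
  not-inner-rail {zero} _ _ = inj₁ refl
  not-inner-rail {suc t} t≤Q+1 not-inner with t ≟ Q
  ... | yes refl = inj₂ refl
  ... | no t≢Q = ⊥-elim (not-inner (s≤s z≤n , ≤∧≢⇒< (≤-pred t≤Q+1) t≢Q))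

  isQCuttable : IsQCuttable Q adj
  isQCuttable cs cyc with any? (IsInner? ∘ decode) cs
  ... | yes has-inner with find has-inner
  ...   | w , w∈ , inner with view w
  ...     | leaf-view valid with () ← subst IsInner (decode-encode valid) inner
  ...     | node-view {i} {j} valid@(i≤K , _) with subst IsInner (decode-encode valid) inner
  ...       | 1≤j , j≤Q with inner-path-window edge-sym (rung-innerPath i≤K) 1≤Q cyc 1≤j j≤Q w∈
  ...         | r , Q≤ , window = r , Q≤ , All.map (λ { (k , 1≤k , k≤Q , refl) → inner-cut i≤K 1≤k k≤Q }) window
  isQCuttable cs cyc | no no-inner =
    ⊥-elim (layering-acyclic railEdge-sym rail-layering cs (restrict-cycle cyc (All.tabulate on-rail)))
    where
    on-rail : ∀ {w} → w ∈ cs → IsRailNode (decode w)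
    on-rail {w} w∈ with view w | All.lookup (¬Any⇒All¬ cs no-inner) w∈
    ... | node-view {i} {j} valid@(_ , j≤) | not-inner =
      subst IsRailNode (sym (decode-encode valid)) (not-inner-rail j≤ (not-inner ∘ subst IsInner (sym (decode-encode valid))))
    ... | leaf-view valid | _ = ⊥-elim (pendant-∉-cycle (leaf-pendant valid) edge-sym cyc w∈)

module LadderLevel (K Q : ℕ) (1≤K : 1 ≤ K) (1≤Q : 1 ≤ Q) where
  open Ladder K Q 1≤K 1≤Q
  open LadderCycles K Q 1≤K 1≤Q

  topRail : ℕ → Fin N × Fin N
  topRail g = encode (node g 0) , encode (node (suc g) 0)

  topRails : List (Fin N × Fin N)
  topRails = map topRail (upFrom 0 K)

  data TopRail : LadderVertex → LadderVertex → Set where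
    top-rail : ∀ {g} → TopRail (node g 0) (node (suc g) 0)

  ∈topRails⇒TopRail : ∀ {x y} → (x , y) ∈ topRails → TopRail (decode x) (decode y)
  ∈topRails⇒TopRail x,y∈ with ∈-map⁻ topRail x,y∈
  ... | g , g∈ , refl with ∈-upFrom⁻ 0 K g∈
  ...   | _ , g<K = subst₂ TopRail (sym (decode-encode (≤-trans (n≤1+n g) (subst (g <_) (+-identityʳ K) g<K) , z≤n)))
                                   (sym (decode-encode (subst (g <_) (+-identityʳ K) g<K , z≤n))) top-rail

  TopRail⇒∈topRails : ∀ {u v} → TopRail u v → Valid v → (encode u , encode v) ∈ topRails
  TopRail⇒∈topRails (top-rail {g}) (g<K , _) = ∈-map⁺ topRail (∈-upFrom⁺ 0 K z≤n (subst (g <_) (sym (+-identityʳ K)) g<K))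

  Kept : Rel N
  Kept = removeEdges (Edge adj) topRails

  topRails-edges : ∀ e → e ∈ topRails → Edge adj (proj₁ e) (proj₂ e)
  topRails-edges _ e∈ with ∈-map⁻ topRail e∈
  ... | g , g∈ , refl = adj⇒edge (inj₁ (rail (inj₁ refl) (subst (g <_) (+-identityʳ K) (proj₂ (∈-upFrom⁻ 0 K g∈)))))

  Kept⇒adj : ∀ {x y} → Kept x y → Adj (decode x) (decode y) × ¬ TopRail (decode x) (decode y) × ¬ TopRail (decode y) (decode x)
  Kept⇒adj {x} {y} (e , ∉) = edge⇒adj e , (λ t → ∉ (inj₁ (in-topRails x y t))) , (λ t → ∉ (inj₂ (in-topRails y x t)))
    where
    in-topRails : ∀ x y → TopRail (decode x) (decode y) → (x , y) ∈ topRails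
    in-topRails x y t =
      subst₂ (λ a b → (a , b) ∈ topRails) (encode-decode x) (encode-decode y) (TopRail⇒∈topRails t (decode-valid y))

  adj⇒Kept : ∀ {u v} → Adj u v → ¬ TopRail u v → ¬ TopRail v u → Kept (encode u) (encode v)
  adj⇒Kept {u} {v} a ¬uv ¬vu = adj⇒edge a , λ
    { (inj₁ ∈) → ¬uv (subst₂ TopRail (decode-encode valid-u) (decode-encode valid-v) (∈topRails⇒TopRail ∈))
    ; (inj₂ ∈) → ¬vu (subst₂ TopRail (decode-encode valid-v) (decode-encode valid-u) (∈topRails⇒TopRail ∈)) }
    where
    valid-u = proj₁ (adj-valid a)
    valid-v = proj₂ (adj-valid a)

  kept-sym : Symmetric Kept
  kept-sym (e , ∉) = edge-sym e , λ { (inj₁ ∈) → ∉ (inj₂ ∈) ; (inj₂ ∈) → ∉ (inj₁ ∈) }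

  -- distance to the corner node 0 (suc Q) in the ladder without its top rail
  depth : LadderVertex → ℕ
  depth (node i j) = i + (suc Q ∸ j)
  depth (leaf i j) = suc (i + (suc Q ∸ j))

  rung-depth : ∀ i {j} → j ≤ Q → depth (node i j) ≡ suc (depth (node i (suc j)))
  rung-depth i j≤Q = trans (cong (i +_) (+-∸-assoc 1 j≤Q)) (+-suc i _)

  depth-step : ∀ {u v} → Adj u v → ¬ TopRail u v → ¬ TopRail v u → depth v ≡ suc (depth u) ⊎ depth u ≡ suc (depth v)
  depth-step (inj₁ (rung {i} _ j≤Q)) _ _ = inj₂ (rung-depth i j≤Q)
  depth-step (inj₁ (rail (inj₁ refl) _)) ¬top _ = ⊥-elim (¬top top-rail)
  depth-step (inj₁ (rail (inj₂ refl) _)) _ _ = inj₁ refl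
  depth-step (inj₁ (pendant _ _)) _ _ = inj₁ refl
  depth-step (inj₂ (rung {i} _ j≤Q)) _ _ = inj₁ (rung-depth i j≤Q)
  depth-step (inj₂ (rail (inj₁ refl) _)) _ ¬top = ⊥-elim (¬top top-rail)
  depth-step (inj₂ (rail (inj₂ refl) _)) _ _ = inj₂ refl
  depth-step (inj₂ (pendant _ _)) _ _ = inj₂ refl

  lower : LadderVertex → LadderVertex
  lower (node i j) with j ≤? Q
  ... | yes _ = node i (suc j)
  ... | no _ = node (pred i) j
  lower (leaf i j) = node i j

  lower-unique : ∀ {u v} → Adj u v → ¬ TopRail u v → ¬ TopRail v u → depth u ≡ suc (depth v) → v ≡ lower u
  lower-unique (inj₁ (rung {i} {j} _ j≤Q)) _ _ _ with j ≤? Q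
  ... | yes _ = refl
  ... | no j≰Q = ⊥-elim (j≰Q j≤Q)
  lower-unique (inj₁ (rail (inj₁ refl) _)) ¬top _ _ = ⊥-elim (¬top top-rail)
  lower-unique (inj₁ (rail (inj₂ refl) _)) _ _ d with () ← n≢2+n d
  lower-unique (inj₁ (pendant _ _)) _ _ d with () ← n≢2+n d
  lower-unique (inj₂ (rung {i} _ j≤Q)) _ _ d with () ← n≢2+n (trans d (cong suc (rung-depth i j≤Q)))
  lower-unique (inj₂ (rail (inj₁ refl) _)) _ ¬top _ = ⊥-elim (¬top top-rail)
  lower-unique (inj₂ (rail (inj₂ refl) _)) _ _ _ with suc Q ≤? Q
  ... | yes Q+1≤Q = ⊥-elim (<-irrefl refl Q+1≤Q)
  ... | no _ = refl
  lower-unique (inj₂ (pendant _ _)) _ _ _ = refl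

  kept-layering : Layering {R = Kept} (depth ∘ decode)
  kept-layering = record
    { adjacent-levels = λ k → let a , ¬uv , ¬vu = Kept⇒adj k in depth-step a ¬uv ¬vu
    ; unique-below = λ x→y x→z y-below z-below → decode-injective (trans (is-lower x→y y-below) (sym (is-lower x→z z-below)))
    }
    where
    is-lower : ∀ {x y} → Kept x y → depth (decode x) ≡ suc (depth (decode y)) → decode y ≡ lower (decode x)
    is-lower k = let a , ¬uv , ¬vu = Kept⇒adj k in lower-unique a ¬uv ¬vu

  step-down : ∀ {u} → Valid u → 0 < depth u → ∃[ v ] Adj u v × ¬ TopRail u v × ¬ TopRail v u × depth v < depth u
  step-down {leaf i j} (i≤K , h) _ = node i j , inj₂ (pendant i≤K h) , (λ ()) , (λ ()) , ≤-refl
  step-down {node i j} (i≤K , j≤) d>0 with j ≤? Q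
  ... | yes j≤Q = node i (suc j) , inj₁ (rung i≤K j≤Q) , (λ ()) , (λ ()) , ≤-reflexive (sym (rung-depth i j≤Q))
  ... | no j≰Q with ≤-antisym j≤ (≰⇒> j≰Q)
  step-down {node zero _} _ d>0 | no _ | refl = ⊥-elim (<-irrefl (sym (n∸n≡0 Q)) d>0)
  step-down {node (suc i) _} (i<K , _) _ | no _ | refl =
    node i (suc Q) , inj₂ (rail (inj₂ refl) i<K) , (λ ()) , (λ ()) , ≤-refl

  kept-descent : Descent Kept (λ _ → ⊤) (depth ∘ decode) (encode (node 0 (suc Q)))
  kept-descent = record { zero⇒root = zero⇒root ; descend = descend }
    where
    zero⇒root : ∀ {x} → ⊤ → depth (decode x) ≡ 0 → x ≡ encode (node 0 (suc Q))
    zero⇒root {x} _ d≡0 with view x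
    ... | leaf-view valid with () ← trans (sym (cong depth (decode-encode valid))) d≡0
    ... | node-view {i} {j} valid@(_ , j≤) with trans (sym (cong depth (decode-encode valid))) d≡0
    ...   | i+Q+1-j≡0 with m+n≡0⇒m≡0 i i+Q+1-j≡0 | ≤-antisym j≤ (m∸n≡0⇒m≤n (m+n≡0⇒n≡0 i i+Q+1-j≡0))
    ...     | refl | refl = refl
    descend : ∀ {x} → ⊤ → 0 < depth (decode x) → ∃[ y ] Kept x y × ⊤ × depth (decode y) < depth (decode x)
    descend {x} _ d>0 with step-down (decode-valid x) d>0
    ... | v , a , ¬uv , ¬vu , d< =
      encode v , subst (λ x′ → Kept x′ (encode v)) (encode-decode x) (adj⇒Kept a ¬uv ¬vu) , tt ,
      subst (_< depth (decode x)) (sym (cong depth (decode-encode (proj₂ (adj-valid a))))) d<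

  level-K : IsLevel K adj
  level-K =
    topRails , topRails-edges ,
    (λ _ _ → topRails , ≤-reflexive (trans (length-map topRail (upFrom 0 K)) (length-upFrom 0 K)) , λ _ e∈ _ → inj₁ e∈) ,
    (λ x y → descent-connectedOn kept-descent kept-sym x y tt tt) ,
    layering-acyclic kept-sym kept-layering

  -- On the edges of a ladder cycle the column sum is the position used in Spans.
  position : Fin N × Fin N → ℕ
  position (x , y) = column (decode x) + column (decode y)

  cycleEdge-position : ∀ {i j u v} → CycleEdge i j u v →
    column u + column v ≡ twice i ⊎ column u + column v ≡ twice j ⊎
    ∃[ g ] i ≤ g × g < j × column u + column v ≡ suc (twice g)
  cycleEdge-position (top {g} i≤g g<j) = inj₂ (inj₂ (g , i≤g , g<j , trans (+-suc g g) (cong suc (sym (twice-+ g)))))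
  cycleEdge-position (far {t} _) = inj₂ (inj₁ (sym (twice-+ _)))
  cycleEdge-position (bottom {g} i≤g g<j) = inj₂ (inj₂ (g , i≤g , g<j , cong suc (sym (twice-+ g))))
  cycleEdge-position (near _) = inj₁ (sym (twice-+ _))

  <⇒suc+ : ∀ {i j} → i < j → ∃[ d ] j ≡ suc d + i
  <⇒suc+ {zero} {suc j} _ = j , cong suc (sym (+-identityʳ j))
  <⇒suc+ {suc i} {suc j} (s≤s i<j) with <⇒suc+ i<j
  ... | d , refl = d , cong suc (sym (+-suc d i))

  position-encode : ∀ {u v} → Valid u → Valid v → position (encode u , encode v) ≡ column u + column v
  position-encode valid-u valid-v = cong₂ _+_ (cong column (decode-encode valid-u)) (cong column (decode-encode valid-v))

  module _ {D L : List (Fin N × Fin N)} (covered : ∀ e → e ∈ D → CoreEdge (proj₁ e) (proj₂ e) → e ∈ L ⊎ swap e ∈ L)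
           {i d : ℕ} (J≤K : suc d + i ≤ K) where
    open Spans (occupied position L)

    clear-cycle-survives : Unhit (twice i) → Unhit (twice (suc d + i)) → RailsUnhit i (suc d + i) →
      IsCycle (removeEdges (Edge adj) D) (ladderCycle i d)
    clear-cycle-survives rung-i rung-J rails = ladderCycle-isCycle i d J≤K _ survives
      where
      unhit : ∀ {u v} → CycleEdge i (suc d + i) u v → Unhit (column u + column v)
      unhit e with cycleEdge-position e
      ... | inj₁ eq rewrite eq = rung-i
      ... | inj₂ (inj₁ eq) rewrite eq = rung-J
      ... | inj₂ (inj₂ (g , i≤g , g<J , eq)) rewrite eq = rails g i≤g g<J
      unlisted : ∀ {u v} → Valid u → Valid v → Unhit (column u + column v) →
        ¬ ((encode u , encode v) ∈ L ⊎ (encode v , encode u) ∈ L)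
      unlisted valid-u valid-v unhit (inj₁ uv∈) with () ←
        trans (sym (occupied-∈ position uv∈)) (trans (cong (occupied position L) (position-encode valid-u valid-v)) unhit)
      unlisted {u} {v} valid-u valid-v unhit (inj₂ vu∈) with () ←
        trans (sym (occupied-∈ position vu∈))
              (trans (cong (occupied position L) (trans (position-encode valid-v valid-u) (+-comm (column v) (column u)))) unhit)
      survives : ∀ {u v} → CycleEdge i (suc d + i) u v → removeEdges (Edge adj) D (encode u) (encode v)
      survives e = adj⇒edge a , λ
        { (inj₁ uv∈D) → unlisted valid-u valid-v (unhit e) (covered _ uv∈D core-uv)
        ; (inj₂ vu∈D) → unlisted valid-u valid-v (unhit e) (swap⊎ (covered _ vu∈D (coreEdge-sym core-uv))) }
        where
        a = cycleEdge-adj (m≤n+m i (suc d)) J≤K e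
        valid-u = proj₁ (adj-valid a)
        valid-v = proj₂ (adj-valid a)
        core-uv = cycleEdge-core (m≤n+m i (suc d)) J≤K e

  not-level : ∀ {k} → k < K → ¬ IsLevel k adj
  not-level k<K (D , _ , in-blob , _ , acyclic) with in-blob core core-isBlob
  ... | L , |L|≤k , covered
      with Spans.clear-span (occupied position L) K (≤-<-trans (≤-trans (hits-occupied position L _) |L|≤k) k<K)
  ...   | i , j , i<j , j≤K , rung-i , rung-j , rails with <⇒suc+ i<j
  ...     | d , refl = acyclic (ladderCycle i d) (clear-cycle-survives covered j≤K rung-i rung-j rails)

single-edge : Fin 2 → Fin 2 → Bool
single-edge zero (suc zero) = true
single-edge (suc zero) zero = true
single-edge _ _ = false

single-edge-connected : (R : Rel 2) → R zero (suc zero) → R (suc zero) zero → Connected R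
single-edge-connected R e₀₁ e₁₀ zero zero = stay zero
single-edge-connected R e₀₁ e₁₀ zero (suc zero) = step e₀₁ (stay _)
single-edge-connected R e₀₁ e₁₀ (suc zero) zero = step e₁₀ (stay _)
single-edge-connected R e₀₁ e₁₀ (suc zero) (suc zero) = stay _

single-edge-isUBN : IsUBN 2 2 single-edge
single-edge-isUBN = record
  { nonemptyX  = s≤s z≤n
  ; symmetric  = λ { zero zero → refl ; zero (suc zero) → refl ; (suc zero) zero → refl ; (suc zero) (suc zero) → refl }
  ; irreflex   = λ { zero → refl ; (suc zero) → refl }
  ; connected  = single-edge-connected _ refl refl
  ; degree13   = λ { zero → inj₁ refl ; (suc zero) → inj₁ refl }
  ; label      = λ i → i
  ; label-inj  = λ _ _ eq → eq
  ; label-leaf = λ { zero → refl ; (suc zero) → refl }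
  ; label-onto = λ v _ → v , refl
  }

single-edge-sym : Symmetric (Edge single-edge)
single-edge-sym {zero} {suc zero} _ = refl
single-edge-sym {suc zero} {zero} _ = refl

single-edge-layering : Layering {R = Edge single-edge} toℕ
single-edge-layering = record { adjacent-levels = levels ; unique-below = below }
  where
  levels : ∀ {x y} → Edge single-edge x y → toℕ y ≡ suc (toℕ x) ⊎ toℕ x ≡ suc (toℕ y)
  levels {zero} {suc zero} _ = inj₁ refl
  levels {suc zero} {zero} _ = inj₂ refl
  below : ∀ {x y z} → Edge single-edge x y → Edge single-edge x z →
    toℕ x ≡ suc (toℕ y) → toℕ x ≡ suc (toℕ z) → y ≡ z
  below {suc zero} {zero} {zero} _ _ _ _ = refl

single-edge-acyclic : ∀ cs → ¬ IsCycle (Edge single-edge) cs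
single-edge-acyclic = layering-acyclic single-edge-sym single-edge-layering

single-edge-level-0 : IsLevel 0 single-edge
single-edge-level-0 =
  [] , (λ _ ()) , (λ _ _ → [] , z≤n , λ _ ()) ,
  single-edge-connected _ (refl , λ { (inj₁ ()) ; (inj₂ ()) }) (refl , λ { (inj₁ ()) ; (inj₂ ()) }) ,
  λ cs cyc → single-edge-acyclic cs (cycle-mono proj₁ cyc)

mainTheorem7 : (k q : ℕ) → 1 ≤ q →
    Σ ℕ λ m → Σ ℕ λ n → Σ (Fin n → Fin n → Bool) λ adj →
      IsUBN m n adj × IsQCuttable q adj × IsStrictlyLevel k adj
mainTheorem7 zero q _ =
  2 , 2 , single-edge , single-edge-isUBN , (λ cs cyc → ⊥-elim (single-edge-acyclic cs cyc)) , single-edge-level-0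
mainTheorem7 (suc k) q 1≤q = length leaves , N , adj , isUBN , isQCuttable , level-K , not-level ≤-refl
  where
  open Ladder (suc k) q (s≤s z≤n) 1≤q
  open LadderQCut (suc k) q (s≤s z≤n) 1≤q
  open LadderLevel (suc k) q (s≤s z≤n) 1≤q
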